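{- (1) If a sequence $\{a_n(q)\}_{n\ge1}\subseteq\mathbb{Z}[q]$ satisfies the $q$-Gauss congruences with respect to a set of primes $S$, then for every $p\in S$ and all $n,k\ge1$, $a_{p^kn}(q)\equiv a_{p^{k-1}n}(q^p)\pmod{[p^k]_q}$. (2) A sequence $\{a_n(q)\}_{n\ge1}\subseteq\mathbb{Z}[q]$ satisfies the $q$-Gauss congruences with respect to the set of all primes if and only if it satisfies the $q$-Gauss congruences.
   Context: $[n]_q=\frac{q^n-1}{q-1}$; $\mu$ is the Möbius function; congruence modulo a polynomial $g$ means divisibility of the difference by $g$ in $\mathbb{Z}[q]$. For a set $S$ of primes, $\mathbb{N}_S$ is the set of positive integers all of whose prime factors lie in $S$. A sequence satisfies the $q$-Gauss congruences with respect to $S$ if for all $n\in\mathbb{N}_S$ and $m\ge1$, $\sum_{d\mid n}\mu(d)a_{nm/d}(q^d)\equiv0\pmod{[n]_q}$; it satisfies the $q$-Gauss congruences if for all $n\ge1$, $\sum_{d\mid n}\mu(d)a_{n/d}(q^d)\equiv0\pmod{[n]_q}$. -}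

module Defs where

open import Data.Nat as ℕ using (ℕ; zero; suc; _≤_; _<_)
open import Data.Nat.Divisibility using (_∣_; _∣?_)
open import Data.Nat.DivMod using (_/_)
open import Data.Nat.Primality using (Prime; prime?)
open import Data.Integer as ℤ using (ℤ; +_; -[1+_])
open import Data.List as L using (List; []; _∷_; upTo; filter; length; replicate; _++_)
open import Data.Bool using (Bool; true; false; if_then_else_)
open import Data.Product using (Σ; _×_)
open import Relation.Binary.PropositionalEquality using (_≡_)
open import Relation.Nullary.Decidable using (⌊_⌋; ¬?)
open import Data.List.Relation.Unary.All using (all?)

-- Polynomials in ℤ[q]: coefficient lists, lowest degree first.

Poly : Set
Poly = List ℤ

coeff : Poly → ℕ → ℤ
coeff []       _       = + 0
coeff (a ∷ _)  zero    = a
coeff (_ ∷ as) (suc i) = coeff as i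

-- equality of polynomials (coefficientwise; trailing zeros irrelevant)
_≈ₚ_ : Poly → Poly → Set
f ≈ₚ g = ∀ i → coeff f i ≡ coeff g i

infixl 6 _+ₚ_ _-ₚ_
infixl 7 _*ₚ_ _·ₚ_

_+ₚ_ : Poly → Poly → Poly
[]       +ₚ g        = g
(a ∷ as) +ₚ []       = a ∷ as
(a ∷ as) +ₚ (b ∷ bs) = (a ℤ.+ b) ∷ (as +ₚ bs)

_·ₚ_ : ℤ → Poly → Poly
c ·ₚ f = L.map (c ℤ.*_) f

-ₚ_ : Poly → Poly
-ₚ f = L.map ℤ.-_ f

_-ₚ_ : Poly → Poly → Poly
f -ₚ g = f +ₚ (-ₚ g)

_*ₚ_ : Poly → Poly → Poly
[]       *ₚ g = []
(a ∷ as) *ₚ g = (a ·ₚ g) +ₚ (+ 0 ∷ (as *ₚ g))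

-- the substitution q ↦ q^d  (for d = suc e)
expand : ℕ → Poly → Poly
expand e []       = []
expand e (a ∷ as) = a ∷ (replicate e (+ 0) ++ expand e as)

_[q^_] : Poly → (d : ℕ) → Poly
f [q^ zero ]  = f   -- unused convention (d ≥ 1 throughout)
f [q^ suc e ] = expand e f

[_]q : ℕ → Poly
[ n ]q = replicate n (+ 1)

_∣ₚ_ : Poly → Poly → Set
g ∣ₚ f = Σ Poly λ h → f ≈ₚ (g *ₚ h)

_≡_[modₚ_] : Poly → Poly → Poly → Set
f ≡ g [modₚ h ] = h ∣ₚ (f -ₚ g)

squarefree : ℕ → Bool
squarefree n = ⌊ all? (λ k → ¬? ((suc (suc k) ℕ.* suc (suc k)) ∣? n)) (upTo n) ⌋

ω : ℕ → ℕ
ω n = length (filter (λ p → prime? p) (filter (_∣? n) (upTo (suc n))))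

μ : ℕ → ℤ
μ n = if squarefree n then (-[1+ 0 ]) ℤ.^ ω n else + 0

sumₚ : List Poly → Poly
sumₚ = L.foldr _+ₚ_ []

-- Σ_{d ∣ n} μ(d) a_{nm/d}(q^d)
gaussSum : (ℕ → Poly) → ℕ → ℕ → Poly
gaussSum a n m =
  sumₚ (L.map (λ i → μ (suc i) ·ₚ (a ((n ℕ.* m) / suc i) [q^ suc i ]))
              (filter (λ i → suc i ∣? n) (upTo n)))

InN : (ℕ → Set) → ℕ → Set
InN S n = (1 ≤ n) × (∀ p → Prime p → p ∣ n → S p)

qGaussWrt : (ℕ → Set) → (ℕ → Poly) → Set
qGaussWrt S a = ∀ n m → InN S n → 1 ≤ m → gaussSum a n m ≡ [] [modₚ [ n ]q ]

qGauss : (ℕ → Poly) → Set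
qGauss a = ∀ n → 1 ≤ n → gaussSum a n 1 ≡ [] [modₚ [ n ]q ]

module Submission where

-- (1) For P = p^k with p ∈ S, the only divisors of P on which μ is nonzero
--     are 1 and p, so the q-Gauss congruence for (P, n) - available since
--     P ∈ N_S - reads  a_{Pn}(q) − a_{Pn/p}(q^p) ≡ 0 (mod [P]_q).
-- (2) "⇒" is the case m = 1.  For "⇐" let g_k = Σ_{d ∣ k} μ(d) a_{k/d}(q^d).
--     Möbius inversion gives a_N = Σ_{d ∣ N} g_{N/d}(q^d); substituting this
--     into the Gauss sum of (n, m) and rearranging yields
--        Σ_{d ∣ n} μ(d) a_{nm/d}(q^d) = Σ_{t ∣ nm, gcd(n,t) = 1} g_{nm/t}(q^t).
--     In each term n divides s = nm/t and [s]_q ∣ g_s by hypothesis, while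
--     [n]_q ∣ [s]_q(q^t) since [n]_q ∣ [n]_{q^t} for gcd(n, t) = 1 (Bézout).

open import Defs
open import Data.Nat using (ℕ; _≤_; _*_; _^_; _∸_)
open import Data.Nat.Primality using (Prime)
open import Data.Product using (_×_)
open import Function.Bundles using (_⇔_; mk⇔)

open import Level using (0ℓ)
open import Algebra.Bundles using (CommutativeMonoid)
open import Data.Nat as ℕ using (zero; suc; _+_; _<_; z≤n; s≤s)
import Data.Nat.Properties as ℕP
open import Data.Integer as ℤ using (ℤ; +_; -[1+_]) renaming (_+_ to _+ᶻ_; _*_ to _*ᶻ_; -_ to -ᶻ_)
import Data.Integer.Properties as ℤP
open import Relation.Binary.PropositionalEquality
  using (_≡_; _≢_; refl; sym; trans; cong; cong₂; subst; module ≡-Reasoning)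
open import Relation.Nullary using (Dec; yes; no; ¬_; does)
import Relation.Unary as U
open import Relation.Nullary.Decidable using (¬?; dec-true; dec-false)
open import Data.Empty using (⊥-elim)
open import Data.Product using (_,_; ∃)
open import Data.List using ([]; _∷_; replicate; _++_)
open import Data.Nat.DivMod using (_/_; _%_; m≡m%n+[m/n]*n; m*n/n≡m; m%n<n; n/1≡n; m/n/o≡m/[n*o]; /-congʳ)
open import Data.Nat.Divisibility
open import Data.Nat.GCD using (gcd; gcd[m,n]∣m; gcd[m,n]∣n; gcd-greatest; module Bézout)
open import Data.Nat.Coprimality using (Coprime; coprime-Bézout; coprime-divisor; gcd≡1⇒coprime)
open import Data.Nat.Primality using (prime?; euclidsLemma; prime⇒irreducible; prime⇒nonZero; prime⇒nonTrivial; ¬prime[0]; ¬prime[1])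
open import Data.Nat.Primality.Factorisation using (factorise)
open import Data.Nat.ListAction using (product)
open import Data.List as L using (upTo; applyUpTo; filter; length)
open import Data.List.Relation.Unary.All using (all?; _∷_)
open import Data.List.Relation.Unary.All.Properties using (applyUpTo⁺₂; applyUpTo⁻)
open import Data.Bool using (Bool; true; false; _∧_)
open import Data.Sum using (_⊎_; inj₁; inj₂; [_,_]′)
open import Function using (id; _∘_)
open import Data.Nat.Solver using (module +-*-Solver)
open +-*-Solver using (solve; _:+_; _:=_; con)
open import Relation.Binary.Bundles using (Setoid)
import Relation.Binary.Reasoning.Setoid as SetoidReasoning

module RangeSum (M : CommutativeMonoid 0ℓ 0ℓ) where

  open CommutativeMonoid M
    renaming (Carrier to A; refl to ≈-refl; sym to ≈-sym; trans to ≈-trans)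
  open import Relation.Binary.Reasoning.Setoid setoid
  open import Algebra.Properties.CommutativeSemigroup commutativeSemigroup using (interchange)

  ∑ : ℕ → (ℕ → A) → A
  ∑ zero    f = ε
  ∑ (suc n) f = ∑ n f ∙ f n

  ∑-cong : ∀ n {f g : ℕ → A} → (∀ i → i < n → f i ≈ g i) → ∑ n f ≈ ∑ n g
  ∑-cong zero    f≈g = ≈-refl
  ∑-cong (suc n) f≈g = ∙-cong (∑-cong n (λ i i<n → f≈g i (ℕP.m<n⇒m<1+n i<n))) (f≈g n ℕP.≤-refl)

  ∑-zero : ∀ n {f : ℕ → A} → (∀ i → i < n → f i ≈ ε) → ∑ n f ≈ ε
  ∑-zero zero    f≈ε = ≈-refl
  ∑-zero (suc n) f≈ε =
    ≈-trans (∙-cong (∑-zero n (λ i i<n → f≈ε i (ℕP.m<n⇒m<1+n i<n))) (f≈ε n ℕP.≤-refl)) (identityˡ ε)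

  ∑-distrib : ∀ n (f g : ℕ → A) → ∑ n (λ i → f i ∙ g i) ≈ ∑ n f ∙ ∑ n g
  ∑-distrib zero    f g = ≈-sym (identityˡ ε)
  ∑-distrib (suc n) f g = ≈-trans (∙-cong (∑-distrib n f g) ≈-refl) (interchange _ _ _ _)

  ∑-swap : ∀ m n (f : ℕ → ℕ → A) → ∑ m (λ i → ∑ n (f i)) ≈ ∑ n (λ j → ∑ m (λ i → f i j))
  ∑-swap zero    n f = ≈-sym (∑-zero n (λ _ _ → ≈-refl))
  ∑-swap (suc m) n f = ≈-trans (∙-cong (∑-swap m n f) ≈-refl) (≈-sym (∑-distrib n _ (f m)))

  ∑-split : ∀ a b (f : ℕ → A) → ∑ (a + b) f ≈ ∑ a f ∙ ∑ b (λ i → f (a + i))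
  ∑-split a zero    f rewrite ℕP.+-identityʳ a = ≈-sym (identityʳ _)
  ∑-split a (suc b) f rewrite ℕP.+-suc a b = ≈-trans (∙-cong (∑-split a b f) ≈-refl) (assoc _ _ _)

  ∑-suc : ∀ n (f : ℕ → A) → ∑ (suc n) f ≈ f 0 ∙ ∑ n (λ i → f (suc i))
  ∑-suc n f = ≈-trans (∑-split 1 n f) (∙-cong (identityˡ (f 0)) ≈-refl)

  ∑-reverse : ∀ n (f : ℕ → A) → ∑ n f ≈ ∑ n (λ k → f (n ∸ suc k))
  ∑-reverse zero    f = ≈-refl
  ∑-reverse (suc n) f = begin
    ∑ n f ∙ f n                               ≈⟨ ∙-cong (∑-reverse n f) ≈-refl ⟩
    ∑ n (λ k → f (n ∸ suc k)) ∙ f n          ≈⟨ comm _ _ ⟩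
    f n ∙ ∑ n (λ k → f (n ∸ suc k))          ≈⟨ ≈-sym (∑-suc n (λ k → f (suc n ∸ suc k))) ⟩
    ∑ (suc n) (λ k → f (suc n ∸ suc k))      ∎

  ∑-extend : ∀ {n m} (f : ℕ → A) → n ≤ m → (∀ i → n ≤ i → i < m → f i ≈ ε) → ∑ n f ≈ ∑ m f
  ∑-extend {n} f n≤m vanish with ℕP.m≤n⇒∃[o]m+o≡n n≤m
  ... | o , refl = begin
    ∑ n f                              ≈⟨ ≈-sym (identityʳ _) ⟩
    ∑ n f ∙ ε                          ≈⟨ ∙-cong ≈-refl (≈-sym (∑-zero o (λ i i<o →
                                            vanish (n + i) (ℕP.m≤m+n n i) (ℕP.+-monoʳ-< n i<o)))) ⟩
    ∑ n f ∙ ∑ o (λ i → f (n + i))      ≈⟨ ≈-sym (∑-split n o f) ⟩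
    ∑ (n + o) f                        ∎

  ∑-single : ∀ n k (f : ℕ → A) → k < n → (∀ i → i < n → i ≢ k → f i ≈ ε) → ∑ n f ≈ f k
  ∑-single (suc n) k f k<1+n vanish with k ℕ.≟ n
  ... | yes refl = ≈-trans (∙-cong (∑-zero n (λ i i<n → vanish i (ℕP.m<n⇒m<1+n i<n) (ℕP.<⇒≢ i<n))) ≈-refl)
                         (identityˡ (f n))
  ... | no k≢n = ≈-trans (∙-cong (∑-single n k f (ℕP.≤∧≢⇒< (ℕP.≤-pred k<1+n) k≢n)
                                   (λ i i<n → vanish i (ℕP.m<n⇒m<1+n i<n)))
                               (vanish n ℕP.≤-refl (k≢n ∘ sym)))
                       (identityʳ (f k))

  ∑-pair : ∀ n k l (f : ℕ → A) → k < l → l < n → (∀ i → i < n → i ≢ k → i ≢ l → f i ≈ ε) →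
           ∑ n f ≈ f k ∙ f l
  ∑-pair (suc n) k l f k<l l<1+n vanish with l ℕ.≟ n
  ... | yes refl = ∙-cong (∑-single n k f k<l (λ i i<n i≢k → vanish i (ℕP.m<n⇒m<1+n i<n) i≢k (ℕP.<⇒≢ i<n))) ≈-refl
  ... | no l≢n = ≈-trans (∙-cong (∑-pair n k l f k<l l<n (λ i i<n → vanish i (ℕP.m<n⇒m<1+n i<n)))
                               (vanish n ℕP.≤-refl (ℕP.<⇒≢ (ℕP.<-trans k<l l<n) ∘ sym) (l≢n ∘ sym)))
                       (identityʳ _)
    where
    l<n = ℕP.≤∧≢⇒< (ℕP.≤-pred l<1+n) l≢n

open RangeSum ℤP.+-0-commutativeMonoid

∑-additive : (h : ℤ → ℤ) → h (+ 0) ≡ + 0 → (∀ x y → h (x +ᶻ y) ≡ h x +ᶻ h y) →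
             ∀ n (f : ℕ → ℤ) → ∑ n (λ i → h (f i)) ≡ h (∑ n f)
∑-additive h h0 h+ zero    f = sym h0
∑-additive h h0 h+ (suc n) f = trans (cong (_+ᶻ h (f n)) (∑-additive h h0 h+ n f)) (sym (h+ _ _))

∑-*ˡ : ∀ n c (f : ℕ → ℤ) → ∑ n (λ i → c *ᶻ f i) ≡ c *ᶻ ∑ n f
∑-*ˡ n c = ∑-additive (c *ᶻ_) (ℤP.*-zeroʳ c) (ℤP.*-distribˡ-+ c) n

∑-neg : ∀ n (f : ℕ → ℤ) → ∑ n (λ i → -ᶻ f i) ≡ -ᶻ ∑ n f
∑-neg = ∑-additive -ᶻ_ refl ℤP.neg-distrib-+

-- Coefficients of the polynomial operations.  Polynomials are compared
-- coefficientwise, so every algebraic law below reduces to a law of ℤ.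

coeff-+ : ∀ f g i → coeff (f +ₚ g) i ≡ coeff f i +ᶻ coeff g i
coeff-+ []       g        i       = sym (ℤP.+-identityˡ (coeff g i))
coeff-+ (a ∷ as) []       i       = sym (ℤP.+-identityʳ (coeff (a ∷ as) i))
coeff-+ (a ∷ as) (b ∷ bs) zero    = refl
coeff-+ (a ∷ as) (b ∷ bs) (suc i) = coeff-+ as bs i

coeff-· : ∀ c f i → coeff (c ·ₚ f) i ≡ c *ᶻ coeff f i
coeff-· c []       i       = sym (ℤP.*-zeroʳ c)
coeff-· c (a ∷ as) zero    = refl
coeff-· c (a ∷ as) (suc i) = coeff-· c as i

coeff-neg : ∀ f i → coeff (-ₚ f) i ≡ -ᶻ coeff f i
coeff-neg []       i       = refl
coeff-neg (a ∷ as) zero    = refl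
coeff-neg (a ∷ as) (suc i) = coeff-neg as i

coeff-- : ∀ f g i → coeff (f -ₚ g) i ≡ coeff f i +ᶻ -ᶻ coeff g i
coeff-- f g i = trans (coeff-+ f (-ₚ g) i) (cong (coeff f i +ᶻ_) (coeff-neg g i))

convolution : (ℕ → ℤ) → (ℕ → ℤ) → ℕ → ℤ
convolution f g i = ∑ (suc i) (λ k → f k *ᶻ g (i ∸ k))

coeff-* : ∀ f g i → coeff (f *ₚ g) i ≡ convolution (coeff f) (coeff g) i
coeff-* []       g i       = sym (∑-zero (suc i) (λ _ _ → refl))
coeff-* (a ∷ as) g zero    = begin
  coeff (a ·ₚ g +ₚ (+ 0 ∷ as *ₚ g)) 0      ≡⟨ coeff-+ (a ·ₚ g) _ 0 ⟩
  coeff (a ·ₚ g) 0 +ᶻ + 0                  ≡⟨ ℤP.+-identityʳ _ ⟩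
  coeff (a ·ₚ g) 0                         ≡⟨ coeff-· a g 0 ⟩
  a *ᶻ coeff g 0                           ≡⟨ sym (ℤP.+-identityˡ _) ⟩
  convolution (coeff (a ∷ as)) (coeff g) 0 ∎
  where open ≡-Reasoning
coeff-* (a ∷ as) g (suc i) = begin
  coeff (a ·ₚ g +ₚ (+ 0 ∷ as *ₚ g)) (suc i)                     ≡⟨ coeff-+ (a ·ₚ g) _ (suc i) ⟩
  coeff (a ·ₚ g) (suc i) +ᶻ coeff (as *ₚ g) i                   ≡⟨ cong₂ _+ᶻ_ (coeff-· a g (suc i)) (coeff-* as g i) ⟩
  a *ᶻ coeff g (suc i) +ᶻ convolution (coeff as) (coeff g) i    ≡⟨ sym (∑-suc (suc i) _) ⟩
  convolution (coeff (a ∷ as)) (coeff g) (suc i)                ∎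
  where open ≡-Reasoning

convolution-comm : ∀ f g i → convolution f g i ≡ convolution g f i
convolution-comm f g i = trans (∑-reverse (suc i) _) (∑-cong (suc i) (λ k k≤i →
  trans (cong (λ j → f (i ∸ k) *ᶻ g j) (ℕP.m∸[m∸n]≡n (ℕP.≤-pred k≤i))) (ℤP.*-comm (f (i ∸ k)) (g k))))

-- Coefficientwise equality of polynomials, wrapped in a record so that the
-- two polynomials can be inferred from a proof.
infix 4 _≋_
record _≋_ (f g : Poly) : Set where
  constructor coeffwise
  field at : f ≈ₚ g
open _≋_

≋-refl : ∀ {f} → f ≋ f
≋-refl = coeffwise (λ _ → refl)

≋-sym : ∀ {f g} → f ≋ g → g ≋ f
≋-sym (coeffwise e) = coeffwise (λ i → sym (e i))

≋-trans : ∀ {f g h} → f ≋ g → g ≋ h → f ≋ h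
≋-trans (coeffwise e) (coeffwise e′) = coeffwise (λ i → trans (e i) (e′ i))

≡⇒≋ : ∀ {f g} → f ≡ g → f ≋ g
≡⇒≋ refl = ≋-refl

≋-setoid : Setoid 0ℓ 0ℓ
≋-setoid = record
  { Carrier = Poly ; _≈_ = _≋_
  ; isEquivalence = record { refl = ≋-refl ; sym = ≋-sym ; trans = ≋-trans } }

module ≋-Reasoning = SetoidReasoning ≋-setoid

+-cong : ∀ {f f′ g g′} → f ≋ f′ → g ≋ g′ → f +ₚ g ≋ f′ +ₚ g′
+-cong {f} {f′} {g} {g′} (coeffwise e) (coeffwise e′) = coeffwise λ i →
  trans (coeff-+ f g i) (trans (cong₂ _+ᶻ_ (e i) (e′ i)) (sym (coeff-+ f′ g′ i)))

neg-cong : ∀ {f g} → f ≋ g → -ₚ f ≋ -ₚ g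
neg-cong {f} {g} (coeffwise e) = coeffwise λ i →
  trans (coeff-neg f i) (trans (cong -ᶻ_ (e i)) (sym (coeff-neg g i)))

*-cong : ∀ {f f′ g g′} → f ≋ f′ → g ≋ g′ → f *ₚ g ≋ f′ *ₚ g′
*-cong {f} {f′} {g} {g′} (coeffwise e) (coeffwise e′) = coeffwise λ i →
  trans (coeff-* f g i) (trans (∑-cong (suc i) (λ k _ → cong₂ _*ᶻ_ (e k) (e′ (i ∸ k))))
                               (sym (coeff-* f′ g′ i)))

∷-cong : ∀ a {f g} → f ≋ g → a ∷ f ≋ a ∷ g
∷-cong a (coeffwise e) = coeffwise λ { zero → refl ; (suc i) → e i }

+-assoc : ∀ f g h → (f +ₚ g) +ₚ h ≋ f +ₚ (g +ₚ h)
+-assoc f g h = coeffwise λ i → begin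
  coeff ((f +ₚ g) +ₚ h) i                     ≡⟨ trans (coeff-+ (f +ₚ g) h i) (cong (_+ᶻ coeff h i) (coeff-+ f g i)) ⟩
  coeff f i +ᶻ coeff g i +ᶻ coeff h i         ≡⟨ ℤP.+-assoc (coeff f i) _ _ ⟩
  coeff f i +ᶻ (coeff g i +ᶻ coeff h i)       ≡⟨ sym (trans (coeff-+ f (g +ₚ h) i) (cong (coeff f i +ᶻ_) (coeff-+ g h i))) ⟩
  coeff (f +ₚ (g +ₚ h)) i                     ∎
  where open ≡-Reasoning

+-identityʳ : ∀ f → f +ₚ [] ≋ f
+-identityʳ f = coeffwise λ i → trans (coeff-+ f [] i) (ℤP.+-identityʳ _)

-‿inverseʳ : ∀ f → f -ₚ f ≋ []
-‿inverseʳ f = coeffwise λ i → trans (coeff-- f f i) (ℤP.+-inverseʳ (coeff f i))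

cons-split : ∀ a f → a ∷ f ≋ (a ∷ []) +ₚ (+ 0 ∷ f)
cons-split a f = coeffwise λ { zero → sym (ℤP.+-identityʳ a) ; (suc i) → refl }

*-comm : ∀ f g → f *ₚ g ≋ g *ₚ f
*-comm f g = coeffwise λ i →
  trans (coeff-* f g i) (trans (convolution-comm (coeff f) (coeff g) i) (sym (coeff-* g f i)))

*-linearʳ : ∀ (φ : Poly → Poly) (h : ℤ → ℤ) → (∀ f i → coeff (φ f) i ≡ h (coeff f i)) →
            h (+ 0) ≡ + 0 → (∀ x y → h (x +ᶻ y) ≡ h x +ᶻ h y) → (∀ x y → x *ᶻ h y ≡ h (x *ᶻ y)) →
            ∀ f g → f *ₚ φ g ≋ φ (f *ₚ g)
*-linearʳ φ h coeff-φ h0 h+ h* f g = coeffwise λ i → begin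
  coeff (f *ₚ φ g) i                               ≡⟨ coeff-* f (φ g) i ⟩
  ∑ (suc i) (λ k → coeff f k *ᶻ coeff (φ g) (i ∸ k)) ≡⟨ ∑-cong (suc i) (λ k _ → trans (cong (coeff f k *ᶻ_) (coeff-φ g (i ∸ k)))
                                                                                   (h* (coeff f k) (coeff g (i ∸ k)))) ⟩
  ∑ (suc i) (λ k → h (coeff f k *ᶻ coeff g (i ∸ k))) ≡⟨ ∑-additive h h0 h+ (suc i) _ ⟩
  h (convolution (coeff f) (coeff g) i)             ≡⟨ cong h (sym (coeff-* f g i)) ⟩
  h (coeff (f *ₚ g) i)                              ≡⟨ sym (coeff-φ (f *ₚ g) i) ⟩
  coeff (φ (f *ₚ g)) i                              ∎
  where open ≡-Reasoning

*-·ʳ : ∀ c f g → f *ₚ (c ·ₚ g) ≋ c ·ₚ (f *ₚ g)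
*-·ʳ c = *-linearʳ (c ·ₚ_) (c *ᶻ_) (coeff-· c) (ℤP.*-zeroʳ c) (ℤP.*-distribˡ-+ c)
                   (λ x y → trans (sym (ℤP.*-assoc x c y)) (trans (cong (_*ᶻ y) (ℤP.*-comm x c)) (ℤP.*-assoc c x y)))

*-neg : ∀ f g → f *ₚ (-ₚ g) ≋ -ₚ (f *ₚ g)
*-neg = *-linearʳ -ₚ_ -ᶻ_ coeff-neg refl ℤP.neg-distrib-+ (λ x y → sym (ℤP.neg-distribʳ-* x y))

*-distribˡ : ∀ f g h → f *ₚ (g +ₚ h) ≋ f *ₚ g +ₚ f *ₚ h
*-distribˡ f g h = coeffwise λ i → begin
  coeff (f *ₚ (g +ₚ h)) i                                   ≡⟨ coeff-* f (g +ₚ h) i ⟩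
  ∑ (suc i) (λ k → coeff f k *ᶻ coeff (g +ₚ h) (i ∸ k))    ≡⟨ ∑-cong (suc i) (λ k _ → trans (cong (coeff f k *ᶻ_) (coeff-+ g h (i ∸ k)))
                                                                                        (ℤP.*-distribˡ-+ (coeff f k) _ _)) ⟩
  ∑ (suc i) (λ k → coeff f k *ᶻ coeff g (i ∸ k) +ᶻ coeff f k *ᶻ coeff h (i ∸ k))
                                                            ≡⟨ ∑-distrib (suc i) _ _ ⟩
  convolution (coeff f) (coeff g) i +ᶻ convolution (coeff f) (coeff h) i
                                                            ≡⟨ sym (trans (coeff-+ (f *ₚ g) (f *ₚ h) i)
                                                                          (cong₂ _+ᶻ_ (coeff-* f g i) (coeff-* f h i))) ⟩
  coeff (f *ₚ g +ₚ f *ₚ h) i                                ∎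
  where open ≡-Reasoning

*-distribʳ : ∀ f g h → (f +ₚ g) *ₚ h ≋ f *ₚ h +ₚ g *ₚ h
*-distribʳ f g h = begin
  (f +ₚ g) *ₚ h          ≈⟨ *-comm (f +ₚ g) h ⟩
  h *ₚ (f +ₚ g)          ≈⟨ *-distribˡ h f g ⟩
  h *ₚ f +ₚ h *ₚ g       ≈⟨ +-cong (*-comm h f) (*-comm h g) ⟩
  f *ₚ h +ₚ g *ₚ h       ∎
  where open ≋-Reasoning

*-·ˡ : ∀ c f g → (c ·ₚ f) *ₚ g ≋ c ·ₚ (f *ₚ g)
*-·ˡ c f g = begin
  (c ·ₚ f) *ₚ g          ≈⟨ *-comm (c ·ₚ f) g ⟩
  g *ₚ (c ·ₚ f)          ≈⟨ *-·ʳ c g f ⟩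
  c ·ₚ (g *ₚ f)          ≈⟨ coeffwise (λ i → trans (coeff-· c (g *ₚ f) i)
                              (trans (cong (c *ᶻ_) (at (*-comm g f) i)) (sym (coeff-· c (f *ₚ g) i)))) ⟩
  c ·ₚ (f *ₚ g)          ∎
  where open ≋-Reasoning

shiftˡ : ∀ f g → (+ 0 ∷ f) *ₚ g ≋ + 0 ∷ (f *ₚ g)
shiftˡ f g = coeffwise λ i → trans (coeff-+ (+ 0 ·ₚ g) (+ 0 ∷ f *ₚ g) i)
  (trans (cong (_+ᶻ coeff (+ 0 ∷ f *ₚ g) i) (trans (coeff-· (+ 0) g i) (ℤP.*-zeroˡ (coeff g i))))
         (ℤP.+-identityˡ _))

*-assoc : ∀ f g h → (f *ₚ g) *ₚ h ≋ f *ₚ (g *ₚ h)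
*-assoc []       g h = ≋-refl
*-assoc (a ∷ as) g h = begin
  (a ·ₚ g +ₚ (+ 0 ∷ as *ₚ g)) *ₚ h            ≈⟨ *-distribʳ (a ·ₚ g) _ h ⟩
  (a ·ₚ g) *ₚ h +ₚ (+ 0 ∷ as *ₚ g) *ₚ h       ≈⟨ +-cong (*-·ˡ a g h)
                                                         (≋-trans (shiftˡ (as *ₚ g) h) (∷-cong (+ 0) (*-assoc as g h))) ⟩
  a ·ₚ (g *ₚ h) +ₚ (+ 0 ∷ as *ₚ (g *ₚ h))     ∎
  where open ≋-Reasoning

*-identityʳ : ∀ f → f *ₚ (+ 1 ∷ []) ≋ f
*-identityʳ f = ≋-trans (*-comm f (+ 1 ∷ [])) (coeffwise λ i →
  trans (coeff-+ (+ 1 ·ₚ f) (+ 0 ∷ []) i)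
        (trans (cong₂ _+ᶻ_ (trans (coeff-· (+ 1) f i) (ℤP.*-identityˡ _)) (coeff-0 i)) (ℤP.+-identityʳ _)))
  where
  coeff-0 : ∀ i → coeff (+ 0 ∷ []) i ≡ + 0
  coeff-0 zero    = refl
  coeff-0 (suc i) = refl

*-zeroʳ : ∀ f → f *ₚ [] ≋ []
*-zeroʳ f = coeffwise λ i → trans (coeff-* f [] i) (∑-zero (suc i) (λ k _ → ℤP.*-zeroʳ (coeff f k)))

when : ∀ {p} {P : Set p} → Dec P → ℤ → ℤ
when (yes _) x = x
when (no _)  _ = + 0

module _ {p} {P : Set p} where

  when-yes : (d : Dec P) → P → ∀ x → when d x ≡ x
  when-yes (yes _) _  x = refl
  when-yes (no ¬p) pf x = ⊥-elim (¬p pf)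

  when-no : (d : Dec P) → ¬ P → ∀ x → when d x ≡ + 0
  when-no (yes pf) ¬p x = ⊥-elim (¬p pf)
  when-no (no _)   _  x = refl

  when-0 : (d : Dec P) → when d (+ 0) ≡ + 0
  when-0 (yes _) = refl
  when-0 (no _)  = refl

  when-+ : (d : Dec P) → ∀ x y → when d (x +ᶻ y) ≡ when d x +ᶻ when d y
  when-+ (yes _) x y = refl
  when-+ (no _)  x y = refl

  when-*ˡ : (d : Dec P) → ∀ c x → when d (c *ᶻ x) ≡ c *ᶻ when d x
  when-*ˡ (yes _) c x = refl
  when-*ˡ (no _)  c x = sym (ℤP.*-zeroʳ c)

  when-neg : (d : Dec P) → ∀ x → when d (-ᶻ x) ≡ -ᶻ when d x
  when-neg (yes _) x = refl
  when-neg (no _)  x = refl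

  when-cong : (d : Dec P) {x y : ℤ} → (P → x ≡ y) → when d x ≡ when d y
  when-cong (yes pf) x≡y = x≡y pf
  when-cong (no _)   x≡y = refl

  when-∑ : (d : Dec P) → ∀ n f → when d (∑ n f) ≡ ∑ n (λ i → when d (f i))
  when-∑ d n f = sym (∑-additive (when d) (when-0 d) (when-+ d) n f)

when-⇔ : ∀ {p q} {P : Set p} {Q : Set q} (d : Dec P) (e : Dec Q) → (P → Q) → (Q → P) →
         ∀ x → when d x ≡ when e x
when-⇔ (yes _) (yes _) _   _   x = refl
when-⇔ (yes p) (no ¬q) p→q _   x = ⊥-elim (¬q (p→q p))
when-⇔ (no ¬p) (yes q) _   q→p x = ⊥-elim (¬p (q→p q))
when-⇔ (no _)  (no _)  _   _   x = refl

when-comm : ∀ {p q} {P : Set p} {Q : Set q} (d : Dec P) (e : Dec Q) →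
            ∀ x → when d (when e x) ≡ when e (when d x)
when-comm (yes _) e       x = refl
when-comm (no _)  (yes _) x = refl
when-comm (no _)  (no _)  x = refl

padded : ℕ → Poly → Poly
padded k g = replicate k (+ 0) ++ g

coeff-padded-+ : ∀ k g x → coeff (padded k g) (k + x) ≡ coeff g x
coeff-padded-+ zero    g x = refl
coeff-padded-+ (suc k) g x = coeff-padded-+ k g x

coeff-padded-< : ∀ k g x → x < k → coeff (padded k g) x ≡ + 0
coeff-padded-< (suc k) g zero    _         = refl
coeff-padded-< (suc k) g (suc x) (s≤s x<k) = coeff-padded-< k g x x<k

coeff-expand-multiple : ∀ e f i → coeff (expand e f) (i * suc e) ≡ coeff f i
coeff-expand-multiple e []       i       = refl
coeff-expand-multiple e (a ∷ as) zero    = refl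
coeff-expand-multiple e (a ∷ as) (suc i) =
  trans (coeff-padded-+ e (expand e as) (i * suc e)) (coeff-expand-multiple e as i)

coeff-expand-gap : ∀ e f r i → r < e → coeff (expand e f) (suc r + i * suc e) ≡ + 0
coeff-expand-gap e []       r i       r<e = refl
coeff-expand-gap e (a ∷ as) r zero    r<e rewrite ℕP.+-identityʳ r = coeff-padded-< e (expand e as) r r<e
coeff-expand-gap e (a ∷ as) r (suc i) r<e =
  trans (cong (coeff (padded e (expand e as))) (reshuffle r e (i * suc e)))
        (trans (coeff-padded-+ e (expand e as) (suc r + i * suc e)) (coeff-expand-gap e as r i r<e))
  where
  reshuffle : ∀ r e x → r + suc (e + x) ≡ e + (suc r + x)
  reshuffle = solve 3 (λ r e x → r :+ (con 1 :+ (e :+ x)) := e :+ (con 1 :+ r :+ x)) refl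

coeff-expand-nonmultiple : ∀ e f j → ¬ (suc e ∣ j) → coeff (expand e f) j ≡ + 0
coeff-expand-nonmultiple e f j ∤j with j % suc e in eq
... | zero  = ⊥-elim (∤j (m%n≡0⇒n∣m j (suc e) eq))
... | suc r = trans (cong (coeff (expand e f)) (trans (m≡m%n+[m/n]*n j (suc e)) (cong (_+ (j / suc e) * suc e) eq)))
                    (coeff-expand-gap e f r (j / suc e) (ℕP.≤-pred (subst (_< suc e) eq (m%n<n j (suc e)))))

coeff-subst : ∀ e f j → coeff (f [q^ suc e ]) j ≡ when (suc e ∣? j) (coeff f (j / suc e))
coeff-subst e f j with suc e ∣? j
... | yes (divides-refl i) = trans (coeff-expand-multiple e f i) (cong (coeff f) (sym (m*n/n≡m i (suc e))))
... | no ∤j                = coeff-expand-nonmultiple e f j ∤j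

coeff-subst-1 : ∀ f j → coeff (f [q^ 1 ]) j ≡ coeff f j
coeff-subst-1 f j = trans (coeff-subst 0 f j) (trans (when-yes (1 ∣? j) (1∣ j) _) (cong (coeff f) (n/1≡n j)))

subst-cong : ∀ e {f g} → f ≋ g → f [q^ suc e ] ≋ g [q^ suc e ]
subst-cong e {f} {g} (coeffwise f≈g) = coeffwise λ j →
  trans (coeff-subst e f j) (trans (cong (when (suc e ∣? j)) (f≈g (j / suc e))) (sym (coeff-subst e g j)))

subst-+ : ∀ e f g → (f +ₚ g) [q^ suc e ] ≋ f [q^ suc e ] +ₚ g [q^ suc e ]
subst-+ e f g = coeffwise λ j → begin
  coeff ((f +ₚ g) [q^ suc e ]) j                          ≡⟨ coeff-subst e (f +ₚ g) j ⟩
  when (suc e ∣? j) (coeff (f +ₚ g) (j / suc e))           ≡⟨ cong (when (suc e ∣? j)) (coeff-+ f g (j / suc e)) ⟩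
  when (suc e ∣? j) (coeff f (j / suc e) +ᶻ coeff g (j / suc e))
                                                          ≡⟨ when-+ (suc e ∣? j) _ _ ⟩
  _                                                       ≡⟨ sym (trans (coeff-+ (f [q^ suc e ]) (g [q^ suc e ]) j)
                                                                        (cong₂ _+ᶻ_ (coeff-subst e f j) (coeff-subst e g j))) ⟩
  coeff (f [q^ suc e ] +ₚ g [q^ suc e ]) j                ∎
  where open ≡-Reasoning

subst-· : ∀ e c f → (c ·ₚ f) [q^ suc e ] ≋ c ·ₚ (f [q^ suc e ])
subst-· e c f = coeffwise λ j → begin
  coeff ((c ·ₚ f) [q^ suc e ]) j                          ≡⟨ coeff-subst e (c ·ₚ f) j ⟩
  when (suc e ∣? j) (coeff (c ·ₚ f) (j / suc e))           ≡⟨ cong (when (suc e ∣? j)) (coeff-· c f (j / suc e)) ⟩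
  when (suc e ∣? j) (c *ᶻ coeff f (j / suc e))             ≡⟨ when-*ˡ (suc e ∣? j) c _ ⟩
  c *ᶻ when (suc e ∣? j) (coeff f (j / suc e))             ≡⟨ sym (trans (coeff-· c (f [q^ suc e ]) j) (cong (c *ᶻ_) (coeff-subst e f j))) ⟩
  coeff (c ·ₚ (f [q^ suc e ])) j                          ∎
  where open ≡-Reasoning

padded-cong : ∀ k {f g} → f ≋ g → padded k f ≋ padded k g
padded-cong zero    f≋g = f≋g
padded-cong (suc k) f≋g = ∷-cong (+ 0) (padded-cong k f≋g)

padded-padded : ∀ m n f → padded m (padded n f) ≡ padded (m + n) f
padded-padded zero    n f = refl
padded-padded (suc m) n f = cong (+ 0 ∷_) (padded-padded m n f)

padded-*ˡ : ∀ k f g → padded k f *ₚ g ≋ padded k (f *ₚ g)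
padded-*ˡ zero    f g = ≋-refl
padded-*ˡ (suc k) f g = ≋-trans (shiftˡ (padded k f) g) (∷-cong (+ 0) (padded-*ˡ k f g))

padded-*ʳ : ∀ k f g → f *ₚ padded k g ≋ padded k (f *ₚ g)
padded-*ʳ k f g = ≋-trans (*-comm f (padded k g))
                 (≋-trans (padded-*ˡ k g f) (padded-cong k (*-comm g f)))

expand-padded : ∀ e k f → expand e (padded k f) ≡ padded (k * suc e) (expand e f)
expand-padded e zero    f = refl
expand-padded e (suc k) f = cong (+ 0 ∷_)
  (trans (cong (padded e) (expand-padded e k f)) (padded-padded e (k * suc e) (expand e f)))

subst-* : ∀ e f g → (f *ₚ g) [q^ suc e ] ≋ f [q^ suc e ] *ₚ g [q^ suc e ]
subst-* e []       g = ≋-refl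
subst-* e (a ∷ as) g = begin
  (a ·ₚ g +ₚ (+ 0 ∷ as *ₚ g)) [q^ suc e ]               ≈⟨ subst-+ e (a ·ₚ g) (+ 0 ∷ as *ₚ g) ⟩
  (a ·ₚ g) [q^ suc e ] +ₚ padded (suc e) (expand e (as *ₚ g))
                                                        ≈⟨ +-cong (subst-· e a g) (padded-cong (suc e) (subst-* e as g)) ⟩
  a ·ₚ G +ₚ padded (suc e) (expand e as *ₚ G)           ≈⟨ +-cong ≋-refl (∷-cong (+ 0) (≋-sym (padded-*ˡ e (expand e as) G))) ⟩
  a ·ₚ G +ₚ (+ 0 ∷ padded e (expand e as) *ₚ G)         ∎
  where
  open ≋-Reasoning
  G = expand e g

subst-subst : ∀ d e f → (f [q^ suc d ]) [q^ suc e ] ≋ f [q^ suc d * suc e ]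
subst-subst d e []       = ≋-refl
subst-subst d e (a ∷ as) = ∷-cong a (≋-trans
  (≡⇒≋ (trans (cong (padded e) (expand-padded e d (expand d as)))
              (padded-padded e (d * suc e) (expand e (expand d as)))))
  (padded-cong (e + d * suc e) (subst-subst d e as)))

qint-+ : ∀ m n → [ m + n ]q ≋ [ m ]q +ₚ padded m [ n ]q
qint-+ zero    n = ≋-refl
qint-+ (suc m) n = ∷-cong (+ 1) (qint-+ m n)

qint-* : ∀ s n′ → [ s * suc n′ ]q ≋ [ suc n′ ]q *ₚ ([ s ]q [q^ suc n′ ])
qint-* zero    n′ = ≋-sym (*-zeroʳ [ suc n′ ]q)
qint-* (suc s) n′ = begin
  [ n + s * n ]q                            ≈⟨ qint-+ n (s * n) ⟩
  N +ₚ padded n [ s * n ]q                  ≈⟨ +-cong (≋-sym (*-identityʳ N)) (padded-cong n (qint-* s n′)) ⟩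
  N *ₚ (+ 1 ∷ []) +ₚ padded n (N *ₚ E)      ≈⟨ +-cong (≋-refl {N *ₚ (+ 1 ∷ [])}) (≋-sym (padded-*ʳ n N E)) ⟩
  N *ₚ (+ 1 ∷ []) +ₚ N *ₚ padded n E        ≈⟨ ≋-sym (*-distribˡ N (+ 1 ∷ []) (padded n E)) ⟩
  N *ₚ (+ 1 ∷ padded n′ E)                  ∎
  where
  open ≋-Reasoning
  n = suc n′
  N = [ n ]q
  E = [ s ]q [q^ n ]

infix 4 _∣≋_
record _∣≋_ (g f : Poly) : Set where
  constructor factor
  field
    cofactor : Poly
    factorisation : f ≋ g *ₚ cofactor

∣≋-resp : ∀ {g f f′} → f ≋ f′ → g ∣≋ f → g ∣≋ f′
∣≋-resp f≋f′ (factor h f≋gh) = factor h (≋-trans (≋-sym f≋f′) f≋gh)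

∣≋-*ʳ : ∀ {g f} k → g ∣≋ f → g ∣≋ f *ₚ k
∣≋-*ʳ {g} k (factor h f≋gh) = factor (h *ₚ k) (≋-trans (*-cong f≋gh ≋-refl) (*-assoc g h k))

∣≋-*ˡ : ∀ {g f} k → g ∣≋ f → g ∣≋ k *ₚ f
∣≋-*ˡ {f = f} k g∣f = ∣≋-resp (*-comm f k) (∣≋-*ʳ k g∣f)

∣≋-+ : ∀ {g f f′} → g ∣≋ f → g ∣≋ f′ → g ∣≋ f +ₚ f′
∣≋-+ {g} (factor h f≋gh) (factor h′ f′≋gh′) = factor (h +ₚ h′) (≋-trans (+-cong f≋gh f′≋gh′) (≋-sym (*-distribˡ g h h′)))

∣≋-neg : ∀ {g f} → g ∣≋ f → g ∣≋ -ₚ f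
∣≋-neg {g} (factor h f≋gh) = factor (-ₚ h) (≋-trans (neg-cong f≋gh) (≋-sym (*-neg g h)))

∣≋-[] : ∀ g → g ∣≋ []
∣≋-[] g = factor [] (≋-sym (*-zeroʳ g))

∣≋⇒∣ₚ : ∀ {g f} → g ∣≋ f → g ∣ₚ f
∣≋⇒∣ₚ (factor h (coeffwise e)) = h , e

≡0⇒∣≋ : ∀ {f h} → f ≡ [] [modₚ h ] → h ∣≋ f
≡0⇒∣≋ {f} (k , e) = ∣≋-resp (+-identityʳ f) (factor k (coeffwise e))

∣≋⇒≡0 : ∀ {f h} → h ∣≋ f → f ≡ [] [modₚ h ]
∣≋⇒≡0 {f} h∣f = ∣≋⇒∣ₚ (∣≋-resp (≋-sym (+-identityʳ f)) h∣f)

∣≋-trans : ∀ {g f k} → g ∣≋ f → f ∣≋ k → g ∣≋ k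
∣≋-trans {g} (factor h f≋gh) (factor h′ k≋fh′) =
  factor (h *ₚ h′) (≋-trans k≋fh′ (≋-trans (*-cong f≋gh ≋-refl) (*-assoc g h h′)))

∣≋-shift : ∀ {g f} → g ∣≋ f → g ∣≋ + 0 ∷ f
∣≋-shift {g} (factor h f≋gh) = factor (+ 0 ∷ h) (≋-trans (∷-cong (+ 0) f≋gh) (≋-sym (padded-*ʳ 1 g h)))

∣≋-subst : ∀ e {g f} → g ∣≋ f → g [q^ suc e ] ∣≋ f [q^ suc e ]
∣≋-subst e {g} (factor h f≋gh) = factor (h [q^ suc e ]) (≋-trans (subst-cong e f≋gh) (subst-* e g h))

qint-∣-multiple : ∀ s n′ → [ suc n′ ]q ∣≋ [ s * suc n′ ]q
qint-∣-multiple s n′ = factor ([ s ]q [q^ suc n′ ]) (qint-* s n′)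

+-cancelʳ : ∀ f X → (f +ₚ X) -ₚ X ≋ f
+-cancelʳ f X = begin
  (f +ₚ X) +ₚ (-ₚ X)      ≈⟨ +-assoc f X (-ₚ X) ⟩
  f +ₚ (X -ₚ X)           ≈⟨ +-cong (≋-refl {f}) (-‿inverseʳ X) ⟩
  f +ₚ []                 ≈⟨ +-identityʳ f ⟩
  f                       ∎
  where open ≋-Reasoning

-- Since [u + 1]_q − q [u]_q = 1, a common divisor of f [u]_q and
-- f [u + 1]_q divides f.
∣≋-consecutive-qints : ∀ {g} f u → g ∣≋ f *ₚ [ u ]q → g ∣≋ f *ₚ [ suc u ]q → g ∣≋ f
∣≋-consecutive-qints f u g∣f[u] g∣f[u+1] =
  ∣≋-resp (+-cancelʳ f X) (∣≋-+ (∣≋-resp f[u+1]≋f+X g∣f[u+1]) (∣≋-neg (∣≋-shift g∣f[u])))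
  where
  open ≋-Reasoning
  X = + 0 ∷ f *ₚ [ u ]q
  f[u+1]≋f+X : f *ₚ [ suc u ]q ≋ f +ₚ X
  f[u+1]≋f+X = begin
    f *ₚ [ suc u ]q                        ≈⟨ *-cong (≋-refl {f}) (cons-split (+ 1) [ u ]q) ⟩
    f *ₚ ((+ 1 ∷ []) +ₚ (+ 0 ∷ [ u ]q))    ≈⟨ *-distribˡ f (+ 1 ∷ []) (+ 0 ∷ [ u ]q) ⟩
    f *ₚ (+ 1 ∷ []) +ₚ f *ₚ padded 1 [ u ]q ≈⟨ +-cong (*-identityʳ f) (padded-*ʳ 1 f [ u ]q) ⟩
    f +ₚ X                                 ∎

qint-subst-swap : ∀ n′ t′ → ([ suc n′ ]q [q^ suc t′ ]) *ₚ [ suc t′ ]q ≋ [ suc n′ ]q *ₚ ([ suc t′ ]q [q^ suc n′ ])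
qint-subst-swap n′ t′ = begin
  ([ n ]q [q^ t ]) *ₚ [ t ]q     ≈⟨ *-comm ([ n ]q [q^ t ]) [ t ]q ⟩
  [ t ]q *ₚ ([ n ]q [q^ t ])     ≈⟨ ≋-sym (qint-* n t′) ⟩
  [ n * t ]q                    ≡⟨ cong [_]q (ℕP.*-comm n t) ⟩
  [ t * n ]q                    ≈⟨ qint-* t n′ ⟩
  [ n ]q *ₚ ([ t ]q [q^ n ])     ∎
  where
  open ≋-Reasoning
  n = suc n′
  t = suc t′

∣-qint-subst-*-multiple-of-n : ∀ n′ t x → [ suc n′ ]q ∣≋ ([ suc n′ ]q [q^ t ]) *ₚ [ x * suc n′ ]q
∣-qint-subst-*-multiple-of-n n′ t x = ∣≋-*ˡ ([ suc n′ ]q [q^ t ]) (qint-∣-multiple x n′)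

∣-qint-subst-*-multiple-of-t : ∀ n′ t′ y → [ suc n′ ]q ∣≋ ([ suc n′ ]q [q^ suc t′ ]) *ₚ [ y * suc t′ ]q
∣-qint-subst-*-multiple-of-t n′ t′ y =
  ∣≋-resp (≋-sym Nt[yt]≋NTnY) (∣≋-*ʳ Y (factor ([ suc t′ ]q [q^ suc n′ ]) ≋-refl))
  where
  open ≋-Reasoning
  Nt = [ suc n′ ]q [q^ suc t′ ]
  Y = [ y ]q [q^ suc t′ ]
  Nt[yt]≋NTnY : Nt *ₚ [ y * suc t′ ]q ≋ ([ suc n′ ]q *ₚ ([ suc t′ ]q [q^ suc n′ ])) *ₚ Y
  Nt[yt]≋NTnY = begin
    Nt *ₚ [ y * suc t′ ]q        ≈⟨ *-cong (≋-refl {Nt}) (qint-* y t′) ⟩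
    Nt *ₚ ([ suc t′ ]q *ₚ Y)     ≈⟨ ≋-sym (*-assoc Nt [ suc t′ ]q Y) ⟩
    (Nt *ₚ [ suc t′ ]q) *ₚ Y     ≈⟨ *-cong (qint-subst-swap n′ t′) (≋-refl {Y}) ⟩
    ([ suc n′ ]q *ₚ ([ suc t′ ]q [q^ suc n′ ])) *ₚ Y ∎

-- The key divisibility: for coprime n and t,  [n]_q ∣ [n]_{q^t}.
-- By Bézout, x n and y t are consecutive integers, so the two previous
-- lemmas and ∣≋-consecutive-qints apply.
qint-∣-subst-coprime : ∀ n′ t′ → Coprime (suc n′) (suc t′) → [ suc n′ ]q ∣≋ [ suc n′ ]q [q^ suc t′ ]
qint-∣-subst-coprime n′ t′ coprime with coprime-Bézout coprime
... | Bézout.+- x y 1+yt≡xn = ∣≋-consecutive-qints _ (y * suc t′)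
        (∣-qint-subst-*-multiple-of-t n′ t′ y)
        (subst (λ k → [ suc n′ ]q ∣≋ ([ suc n′ ]q [q^ suc t′ ]) *ₚ [ k ]q) (sym 1+yt≡xn)
               (∣-qint-subst-*-multiple-of-n n′ (suc t′) x))
... | Bézout.-+ x y 1+xn≡yt = ∣≋-consecutive-qints _ (x * suc n′)
        (∣-qint-subst-*-multiple-of-n n′ (suc t′) x)
        (subst (λ k → [ suc n′ ]q ∣≋ ([ suc n′ ]q [q^ suc t′ ]) *ₚ [ k ]q) (sym 1+xn≡yt)
               (∣-qint-subst-*-multiple-of-t n′ t′ y))

qint-∣-subst-of-multiple : ∀ n′ t′ s c → Coprime (suc n′) (suc t′) → [ s * suc n′ ]q ∣≋ c →
                            [ suc n′ ]q ∣≋ c [q^ suc t′ ]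
qint-∣-subst-of-multiple n′ t′ s c coprime [sn]∣c =
  ∣≋-trans (qint-∣-subst-coprime n′ t′ coprime) (∣≋-subst t′ (∣≋-trans (qint-∣-multiple s n′) [sn]∣c))

prime>1 : ∀ {p} → Prime p → 1 < p
prime>1 {p} pp = ℕ.nonTrivial⇒n>1 p ⦃ prime⇒nonTrivial pp ⦄

prime>0 : ∀ {p} → Prime p → 0 < p
prime>0 pp = ℕP.<-trans (s≤s z≤n) (prime>1 pp)

prime∤⇒coprime : ∀ {p d} → Prime p → ¬ p ∣ d → Coprime d p
prime∤⇒coprime pp p∤d (c∣d , c∣p) with prime⇒irreducible pp c∣p
... | inj₁ c≡1 = c≡1
... | inj₂ refl = ⊥-elim (p∤d c∣d)

prime-factor : ∀ g → 2 ≤ g → ∃ λ p → Prime p × p ∣ g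
prime-factor g 2≤g with factorise g ⦃ ℕ.>-nonZero (ℕP.<-trans (s≤s z≤n) 2≤g) ⦄
... | record { factors = [] ; isFactorisation = eq } = ⊥-elim (ℕP.<-irrefl (sym eq) 2≤g)
... | record { factors = p ∷ ps ; isFactorisation = eq ; factorsPrime = pp ∷ _ } =
  p , pp , subst (p ∣_) (sym eq) (m∣m*n (product ps))

prime∣prime^ : ∀ {r p} → Prime r → Prime p → ∀ k → r ∣ p ^ k → r ≡ p
prime∣prime^ rr pp zero r∣1 = ⊥-elim (¬prime[1] (subst Prime (∣1⇒≡1 r∣1) rr))
prime∣prime^ {r} {p} rr pp (suc k) r∣p^k+1 with euclidsLemma p (p ^ k) rr r∣p^k+1
... | inj₂ r∣p^k = prime∣prime^ rr pp k r∣p^k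
... | inj₁ r∣p with prime⇒irreducible pp r∣p
...   | inj₁ refl = ⊥-elim (¬prime[1] rr)
...   | inj₂ r≡p  = r≡p

prime^-divisor : ∀ {p} → Prime p → ∀ k d → d ∣ p ^ k → d ≡ 1 ⊎ d ≡ p ⊎ p * p ∣ d
prime^-divisor pp zero d d∣1 = inj₁ (∣1⇒≡1 d∣1)
prime^-divisor {p} pp (suc k) d d∣p^k+1 with p ∣? d
... | yes (divides d′ refl)
  with prime^-divisor pp k d′ (*-cancelʳ-∣ p ⦃ prime⇒nonZero pp ⦄ (subst (d′ * p ∣_) (ℕP.*-comm p (p ^ k)) d∣p^k+1))
...   | inj₁ refl              = inj₂ (inj₁ (ℕP.*-identityˡ p))
...   | inj₂ (inj₁ refl)       = inj₂ (inj₂ ∣-refl)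
...   | inj₂ (inj₂ p²∣d′)      = inj₂ (inj₂ (∣m⇒∣m*n p p²∣d′))
prime^-divisor {p} pp (suc k) d d∣p^k+1 | no p∤d
  with prime^-divisor pp k d (coprime-divisor (prime∤⇒coprime pp p∤d) d∣p^k+1)
...   | inj₁ d≡1               = inj₁ d≡1
...   | inj₂ (inj₁ refl)       = ⊥-elim (p∤d ∣-refl)
...   | inj₂ (inj₂ p²∣d)       = ⊥-elim (p∤d (∣-trans (m∣m*n p) p²∣d))

SquareFree : ℕ → Set
SquareFree n = ∀ m → 2 ≤ m → ¬ (m * m ∣ n)

squarefree-complete : ∀ n → SquareFree n → squarefree n ≡ true
squarefree-complete n sf with all? (λ k → ¬? ((suc (suc k) * suc (suc k)) ∣? n)) (upTo n)
... | yes _   = refl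
... | no ¬all = ⊥-elim (¬all (applyUpTo⁺₂ id n (λ k → sf (suc (suc k)) (s≤s (s≤s z≤n)))))

squarefree-false : ∀ n m → 1 ≤ n → 2 ≤ m → m * m ∣ n → squarefree n ≡ false
squarefree-false n (suc zero) _ (s≤s ()) _
squarefree-false n (suc (suc k)) 1≤n _ m²∣n
  with all? (λ k → ¬? ((suc (suc k) * suc (suc k)) ∣? n)) (upTo n)
... | yes all = ⊥-elim (applyUpTo⁻ id n all k<n m²∣n)
  where
  k<n : k < n
  k<n = ℕP.<-≤-trans (ℕP.≤-trans (ℕP.n≤1+n (suc k)) (ℕP.m≤m*n (suc (suc k)) (suc (suc k))))
                     (∣⇒≤ ⦃ ℕ.>-nonZero 1≤n ⦄ m²∣n)
... | no _    = refl

squarefree-sound : ∀ n → 1 ≤ n → squarefree n ≡ true → SquareFree n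
squarefree-sound n 1≤n sq m 2≤m m²∣n with trans (sym sq) (squarefree-false n m 1≤n 2≤m m²∣n)
... | ()

SquareFree-prime-* : ∀ p e → Prime p → ¬ p ∣ e → SquareFree e → SquareFree (p * e)
SquareFree-prime-* p e pp p∤e sf m 2≤m m²∣pe with p ∣? m
... | yes p∣m = p∤e (*-cancelˡ-∣ p ⦃ prime⇒nonZero pp ⦄ (∣-trans (*-pres-∣ p∣m p∣m) m²∣pe))
... | no p∤m  = sf m 2≤m (coprime-divisor coprime m²∣pe)
  where
  coprime : Coprime (m * m) p
  coprime (d∣m² , d∣p) with prime⇒irreducible pp d∣p
  ... | inj₁ d≡1 = d≡1
  ... | inj₂ refl = ⊥-elim ([ p∤m , p∤m ]′ (euclidsLemma m m pp d∣m²))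

SquareFree-*⁻ : ∀ p e → SquareFree (p * e) → SquareFree e
SquareFree-*⁻ p e sf m 2≤m m²∣e = sf m 2≤m (∣n⇒∣m*n p m²∣e)

module ℕΣ = RangeSum ℕP.+-0-commutativeMonoid

indicator : Bool → ℕ
indicator true  = 1
indicator false = 0

length-filter-filter : ∀ {a b} {P : ℕ → Set a} {Q : ℕ → Set b} (P? : U.Decidable P) (Q? : U.Decidable Q) g R →
  length (filter Q? (filter P? (applyUpTo g R))) ≡ ℕΣ.∑ R (λ k → indicator (does (P? (g k)) ∧ does (Q? (g k))))
length-filter-filter P? Q? g zero = refl
length-filter-filter P? Q? g (suc R)
  rewrite ℕΣ.∑-suc R (λ k → indicator (does (P? (g k)) ∧ does (Q? (g k)))) with P? (g 0)
... | no _ = length-filter-filter P? Q? (λ k → g (suc k)) R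
... | yes _ with Q? (g 0)
...   | yes _ = cong suc (length-filter-filter P? Q? (λ k → g (suc k)) R)
...   | no _  = length-filter-filter P? Q? (λ k → g (suc k)) R

isPrimeDivisor : ℕ → ℕ → ℕ
isPrimeDivisor n k = indicator (does (k ∣? n) ∧ does (prime? k))

ω-as-sum : ∀ n → ω n ≡ ℕΣ.∑ (suc n) (isPrimeDivisor n)
ω-as-sum n = length-filter-filter (_∣? n) prime? id (suc n)

isPrimeDivisor-prime-* : ∀ p e k → Prime p → ¬ p ∣ e →
  isPrimeDivisor (p * e) k ≡ isPrimeDivisor e k + indicator (does (k ℕ.≟ p))
isPrimeDivisor-prime-* p e k pp p∤e with k ℕ.≟ p
... | yes refl = trans at-p (cong (isPrimeDivisor e p ℕ.+_) (cong indicator (sym (dec-true (p ℕ.≟ p) refl))))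
  where
  at-p : isPrimeDivisor (p * e) p ≡ isPrimeDivisor e p + 1
  at-p with p ∣? p * e | p ∣? e | prime? p
  ... | yes _   | no _    | yes _  = refl
  ... | no p∤pe | _       | _      = ⊥-elim (p∤pe (m∣m*n e))
  ... | _       | yes p∣e | _      = ⊥-elim (p∤e p∣e)
  ... | _       | _       | no ¬pp = ⊥-elim (¬pp pp)
... | no k≢p = trans away-from-p (cong (isPrimeDivisor e k ℕ.+_) (cong indicator (sym (dec-false (k ℕ.≟ p) k≢p))))
  where
  away-from-p : isPrimeDivisor (p * e) k ≡ isPrimeDivisor e k + 0
  away-from-p with k ∣? p * e | k ∣? e | prime? k
  ... | yes _    | yes _   | _     = sym (ℕP.+-identityʳ _)
  ... | no _     | no _    | _     = refl
  ... | yes _    | no _    | no _  = refl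
  ... | no k∤pe  | yes k∣e | _     = ⊥-elim (k∤pe (∣n⇒∣m*n p k∣e))
  ... | yes k∣pe | no k∤e  | yes kp with euclidsLemma p e kp k∣pe
  ...   | inj₂ k∣e = ⊥-elim (k∤e k∣e)
  ...   | inj₁ k∣p with prime⇒irreducible pp k∣p
  ...     | inj₁ refl = ⊥-elim (¬prime[1] kp)
  ...     | inj₂ k≡p  = ⊥-elim (k≢p k≡p)

ω-prime-* : ∀ p e → Prime p → ¬ p ∣ e → 1 ≤ e → ω (p * e) ≡ suc (ω e)
ω-prime-* p e pp p∤e 1≤e = begin
  ω (p * e)                                                   ≡⟨ ω-as-sum (p * e) ⟩
  ℕΣ.∑ (suc (p * e)) (isPrimeDivisor (p * e))                ≡⟨ ℕΣ.∑-cong (suc (p * e)) (λ k _ → isPrimeDivisor-prime-* p e k pp p∤e) ⟩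
  ℕΣ.∑ (suc (p * e)) (λ k → isPrimeDivisor e k + indicator (does (k ℕ.≟ p)))
                                                              ≡⟨ ℕΣ.∑-distrib (suc (p * e)) _ _ ⟩
  ℕΣ.∑ (suc (p * e)) (isPrimeDivisor e) + ℕΣ.∑ (suc (p * e)) (λ k → indicator (does (k ℕ.≟ p)))
                                                              ≡⟨ cong₂ _+_ (sym beyond-e) just-p ⟩
  ℕΣ.∑ (suc e) (isPrimeDivisor e) + 1                         ≡⟨ ℕP.+-comm _ 1 ⟩
  suc (ℕΣ.∑ (suc e) (isPrimeDivisor e))                       ≡⟨ cong suc (sym (ω-as-sum e)) ⟩
  suc (ω e)                                                   ∎
  where
  open ≡-Reasoning
  instance
    _ = ℕ.>-nonZero 1≤e
    _ = prime⇒nonZero pp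
  beyond-e : ℕΣ.∑ (suc e) (isPrimeDivisor e) ≡ ℕΣ.∑ (suc (p * e)) (isPrimeDivisor e)
  beyond-e = ℕΣ.∑-extend (isPrimeDivisor e) (s≤s (ℕP.m≤n*m e p)) vanish
    where
    vanish : ∀ k → suc e ≤ k → k < suc (p * e) → isPrimeDivisor e k ≡ 0
    vanish k e<k _ with k ∣? e
    ... | yes k∣e = ⊥-elim (ℕP.<-irrefl refl (ℕP.<-≤-trans e<k (∣⇒≤ k∣e)))
    ... | no _    = refl
  just-p : ℕΣ.∑ (suc (p * e)) (λ k → indicator (does (k ℕ.≟ p))) ≡ 1
  just-p = trans (ℕΣ.∑-single (suc (p * e)) p _ (s≤s (ℕP.m≤m*n p e)) vanish) (cong indicator (dec-true (p ℕ.≟ p) refl))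
    where
    vanish : ∀ k → k < suc (p * e) → k ≢ p → indicator (does (k ℕ.≟ p)) ≡ 0
    vanish k _ k≢p = cong indicator (dec-false (k ℕ.≟ p) k≢p)

μ-non-squarefree : ∀ m x → 2 ≤ m → m * m ∣ x → 1 ≤ x → μ x ≡ + 0
μ-non-squarefree m x 2≤m m²∣x 1≤x rewrite squarefree-false x m 1≤x 2≤m m²∣x = refl

μ-prime-* : ∀ p e → Prime p → ¬ p ∣ e → 1 ≤ e → μ (p * e) ≡ -ᶻ μ e
μ-prime-* p e pp p∤e 1≤e with squarefree e in sq
... | true rewrite squarefree-complete (p * e) (SquareFree-prime-* p e pp p∤e (squarefree-sound e 1≤e sq))
                 | ω-prime-* p e pp p∤e 1≤e = ℤP.-1*i≡-i _
... | false with squarefree (p * e) in sq′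
...   | false = refl
...   | true with trans (sym (squarefree-complete e (SquareFree-*⁻ p e (squarefree-sound (p * e) 1≤pe sq′)))) sq
  where 1≤pe = ℕP.*-mono-≤ (prime>0 pp) 1≤e
...     | ()

μ-prime : ∀ p → Prime p → μ p ≡ -[1+ 0 ]
μ-prime p pp = trans (cong μ (sym (ℕP.*-identityʳ p)))
                     (μ-prime-* p 1 pp (λ p∣1 → ℕP.<-irrefl (sym (∣1⇒≡1 p∣1)) (prime>1 pp)) (s≤s z≤n))

μ-*-prime : ∀ d p → Prime p → 1 ≤ d → μ (d * p) ≡ -ᶻ when (¬? (p ∣? d)) (μ d)
μ-*-prime d p pp 1≤d with p ∣? d
... | yes p∣d = μ-non-squarefree p (d * p) (prime>1 pp) (*-monoˡ-∣ p p∣d) (ℕP.*-mono-≤ 1≤d (prime>0 pp))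
... | no p∤d  = trans (cong μ (ℕP.*-comm d p)) (μ-prime-* p d pp p∤d 1≤d)

when-split : ∀ {p} {P : Set p} (d : Dec P) x → x ≡ when d x +ᶻ when (¬? d) x
when-split (yes _) x = sym (ℤP.+-identityʳ x)
when-split (no _)  x = sym (ℤP.+-identityˡ x)

when-redundant : ∀ {p q} {P : Set p} {Q : Set q} (d : Dec P) (e : Dec Q) → (Q → P) →
                 ∀ x → when d (when e x) ≡ when e x
when-redundant d e Q→P x = trans (when-comm d e x) (when-cong e (λ q → when-yes d (Q→P q) x))

when-when : ∀ {p q r} {P : Set p} {Q : Set q} {R : Set r} (d : Dec P) (e : Dec Q) (f : Dec R) →
            (P → Q → R) → (R → P) → (R → Q) → ∀ x → when d (when e x) ≡ when f x
when-when (yes _) (yes _) (yes _) _ _   _   x = refl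
when-when (yes p) (yes q) (no ¬r) h _   _   x = ⊥-elim (¬r (h p q))
when-when (yes _) (no ¬q) (yes r) _ _   R→Q x = ⊥-elim (¬q (R→Q r))
when-when (yes _) (no _)  (no _)  _ _   _   x = refl
when-when (no ¬p) _       (yes r) _ R→P _   x = ⊥-elim (¬p (R→P r))
when-when (no _)  _       (no _)  _ _   _   x = refl

-- Divisor sums   Σ_{d ∣ N} F d = ∑_{i < N} [i + 1 ∣ N] F (i + 1).

divisorSum : ℕ → (ℕ → ℤ) → ℤ
divisorSum N F = ∑ N (λ i → when (suc i ∣? N) (F (suc i)))

divisor-bound : ∀ {N i} → 1 ≤ N → N ≤ i → ¬ (suc i ∣ N)
divisor-bound 1≤N N≤i i+1∣N = ℕP.<-irrefl refl (ℕP.≤-trans (s≤s N≤i) (∣⇒≤ ⦃ ℕ.>-nonZero 1≤N ⦄ i+1∣N))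

divisorSum-extend : ∀ N M (F : ℕ → ℤ) → 1 ≤ N → N ≤ M →
                    divisorSum N F ≡ ∑ M (λ i → when (suc i ∣? N) (F (suc i)))
divisorSum-extend N M F 1≤N N≤M = ∑-extend _ N≤M (λ i N≤i _ → when-no (suc i ∣? N) (divisor-bound 1≤N N≤i) _)

∑-multiples : ∀ K e′ (H : ℕ → ℤ) →
              ∑ K (λ i → H (suc i * suc e′)) ≡ ∑ (K * suc e′) (λ t → when (suc e′ ∣? suc t) (H (suc t)))
∑-multiples zero    e′ H = refl
∑-multiples (suc K) e′ H = sym (begin
  ∑ (e + K * e) F                                ≡⟨ cong (λ n → ∑ n F) (ℕP.+-comm e (K * e)) ⟩
  ∑ (K * e + e) F                                ≡⟨ ∑-split (K * e) e F ⟩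
  ∑ (K * e) F +ᶻ ∑ e (λ r → F (K * e + r))       ≡⟨ cong₂ _+ᶻ_ (sym (∑-multiples K e′ H)) last-block ⟩
  ∑ K (λ i → H (suc i * e)) +ᶻ H (e + K * e)     ∎)
  where
  open ≡-Reasoning
  e = suc e′
  F = λ t → when (e ∣? suc t) (H (suc t))
  top : suc (K * e + e′) ≡ e + K * e
  top = trans (sym (ℕP.+-suc (K * e) e′)) (ℕP.+-comm (K * e) e)
  gap : ∀ r → r < e → r ≢ e′ → ¬ (e ∣ suc (K * e + r))
  gap r r<e r≢e′ e∣ = ℕP.<-irrefl refl (ℕP.<-≤-trans (s≤s (ℕP.≤∧≢⇒< (ℕP.≤-pred r<e) r≢e′))
    (∣⇒≤ (∣m+n∣m⇒∣n (subst (e ∣_) (sym (ℕP.+-suc (K * e) r)) e∣) (n∣m*n K))))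
  last-block : ∑ e (λ r → F (K * e + r)) ≡ H (e + K * e)
  last-block = trans (∑-single e e′ _ ℕP.≤-refl (λ r r<e r≢e′ → when-no (e ∣? _) (gap r r<e r≢e′) _))
    (trans (when-yes (e ∣? _) (subst (e ∣_) (sym top) (∣m∣n⇒∣m+n ∣-refl (n∣m*n K))) _) (cong H top))

∑-multiples-dividing : ∀ N e′ (G : ℕ → ℤ) → 1 ≤ N →
  ∑ N (λ i → when (suc i * suc e′ ∣? N) (G (suc i * suc e′)))
    ≡ ∑ N (λ t → when (suc e′ ∣? suc t) (when (suc t ∣? N) (G (suc t))))
∑-multiples-dividing N e′ G 1≤N = trans (∑-multiples N e′ (λ x → when (x ∣? N) (G x)))
  (sym (∑-extend _ (ℕP.m≤m*n N (suc e′)) (λ t N≤t _ →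
    trans (cong (when (suc e′ ∣? suc t)) (when-no (suc t ∣? N) (divisor-bound 1≤N N≤t) _)) (when-0 (suc e′ ∣? suc t)))))

-- For d ∣ N the divisors of N / d are the i with i d ∣ N:
--   [d ∣ N] Σ_{i ∣ N/d} X i = Σ_{i : i d ∣ N} X i.
divisorSum-quotient : ∀ N d′ (X : ℕ → ℤ) → 1 ≤ N →
  when (suc d′ ∣? N) (divisorSum (N / suc d′) X) ≡ ∑ N (λ i → when (suc i * suc d′ ∣? N) (X (suc i)))
divisorSum-quotient N d′ X 1≤N with suc d′ ∣? N
... | no d∤N = sym (∑-zero N (λ i _ → when-no (suc i * suc d′ ∣? N) (λ id∣N → d∤N (m*n∣⇒n∣ (suc i) (suc d′) id∣N)) _))
divisorSum-quotient .(zero * suc d′) d′ X () | yes (divides-refl zero)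
... | yes (divides-refl (suc q′)) = begin
  divisorSum (q * d / d) X                                   ≡⟨ cong (λ n → divisorSum n X) (m*n/n≡m q d) ⟩
  divisorSum q X                                             ≡⟨ ∑-cong q (λ i _ → when-⇔ (suc i ∣? q) (suc i * d ∣? q * d)
                                                                         (*-monoˡ-∣ d) (*-cancelʳ-∣ d) _) ⟩
  ∑ q (λ i → when (suc i * d ∣? q * d) (X (suc i)))          ≡⟨ ∑-extend _ (ℕP.m≤m*n q d) (λ i q≤i _ →
                                                                 when-no (suc i * d ∣? q * d) (divisor-bound (s≤s z≤n) q≤i ∘ *-cancelʳ-∣ d) _) ⟩
  ∑ (q * d) (λ i → when (suc i * d ∣? q * d) (X (suc i)))    ∎
  where
  open ≡-Reasoning
  q = suc q′
  d = suc d′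

-- For g = q p with p prime, split the divisors d of g according to p ∣ d:
-- the divisors d = d′ p contribute −Σ_{d′ ∣ q, p ∤ d′} μ d′, exactly
-- cancelling the contribution of the divisors prime to p.
möbius-sum-multiple-of-prime : ∀ q p′ → Prime (suc p′) → 1 ≤ q → divisorSum (q * suc p′) μ ≡ + 0
möbius-sum-multiple-of-prime q p′ pp 1≤q = begin
  ∑ N (λ i → when (suc i ∣? N) (μ (suc i)))
    ≡⟨ ∑-cong N (λ i _ → when-split (p ∣? suc i) (when (suc i ∣? N) (μ (suc i)))) ⟩
  ∑ N (λ i → when (p ∣? suc i) (when (suc i ∣? N) (μ (suc i))) +ᶻ when (¬? (p ∣? suc i)) (when (suc i ∣? N) (μ (suc i))))
    ≡⟨ ∑-distrib N _ _ ⟩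
  ∑ N (λ i → when (p ∣? suc i) (when (suc i ∣? N) (μ (suc i)))) +ᶻ ∑ N (λ i → when (¬? (p ∣? suc i)) (when (suc i ∣? N) (μ (suc i))))
    ≡⟨ cong₂ _+ᶻ_ multiples-of-p prime-to-p ⟩
  -ᶻ X +ᶻ X
    ≡⟨ ℤP.+-inverseˡ X ⟩
  + 0 ∎
  where
  open ≡-Reasoning
  p = suc p′
  N = q * p
  q≤N : q ≤ N
  q≤N = ℕP.m≤m*n q p
  X = divisorSum q (λ d → when (¬? (p ∣? d)) (μ d))
  multiples-of-p : ∑ N (λ i → when (p ∣? suc i) (when (suc i ∣? N) (μ (suc i)))) ≡ -ᶻ X
  multiples-of-p = begin
    ∑ N (λ i → when (p ∣? suc i) (when (suc i ∣? N) (μ (suc i))))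
      ≡⟨ sym (∑-multiples-dividing N p′ μ (ℕP.≤-trans 1≤q q≤N)) ⟩
    ∑ N (λ i → when (suc i * p ∣? N) (μ (suc i * p)))
      ≡⟨ ∑-cong N (λ i _ → when-⇔ (suc i * p ∣? N) (suc i ∣? q) (*-cancelʳ-∣ p) (*-monoˡ-∣ p) _) ⟩
    ∑ N (λ i → when (suc i ∣? q) (μ (suc i * p)))
      ≡⟨ sym (divisorSum-extend q N (λ d → μ (d * p)) 1≤q q≤N) ⟩
    divisorSum q (λ d → μ (d * p))
      ≡⟨ ∑-cong q (λ i _ → trans (cong (when (suc i ∣? q)) (μ-*-prime (suc i) p pp (s≤s z≤n))) (when-neg (suc i ∣? q) _)) ⟩
    ∑ q (λ i → -ᶻ when (suc i ∣? q) (when (¬? (p ∣? suc i)) (μ (suc i))))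
      ≡⟨ ∑-neg q _ ⟩
    -ᶻ X ∎
  -- A divisor of q p prime to p divides q.
  prime-to-p : ∑ N (λ i → when (¬? (p ∣? suc i)) (when (suc i ∣? N) (μ (suc i)))) ≡ X
  prime-to-p = begin
    ∑ N (λ i → when (¬? (p ∣? suc i)) (when (suc i ∣? N) (μ (suc i))))
      ≡⟨ ∑-cong N (λ i _ → trans (when-cong (¬? (p ∣? suc i)) (λ p∤d → when-⇔ (suc i ∣? N) (suc i ∣? q)
              (λ d∣N → coprime-divisor (prime∤⇒coprime pp p∤d) (subst (suc i ∣_) (ℕP.*-comm q p) d∣N))
              (∣m⇒∣m*n p) _))
            (when-comm (¬? (p ∣? suc i)) (suc i ∣? q) _)) ⟩
    ∑ N (λ i → when (suc i ∣? q) (when (¬? (p ∣? suc i)) (μ (suc i))))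
      ≡⟨ sym (divisorSum-extend q N (λ d → when (¬? (p ∣? d)) (μ d)) 1≤q q≤N) ⟩
    X ∎

möbius-sum : ∀ g → 1 ≤ g → divisorSum g μ ≡ when (g ℕ.≟ 1) (+ 1)
möbius-sum (suc zero)    _ = refl
möbius-sum (suc (suc g)) _ with prime-factor (suc (suc g)) (s≤s (s≤s z≤n))
... | zero , pp , _ = ⊥-elim (¬prime[0] pp)
... | suc p′ , pp , divides q eq = trans (cong (λ n → divisorSum n μ) eq)
        (möbius-sum-multiple-of-prime q p′ pp (positive-cofactor q eq))
  where
  positive-cofactor : ∀ q → suc (suc g) ≡ q * suc p′ → 1 ≤ q
  positive-cofactor zero    ()
  positive-cofactor (suc q) _ = s≤s z≤n

coeff-sumₚ-filter : ∀ {ℓ} {P : ℕ → Set ℓ} (P? : U.Decidable P) (F : ℕ → Poly) (g : ℕ → ℕ) n j →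
  coeff (sumₚ (L.map F (filter P? (applyUpTo g n)))) j ≡ ∑ n (λ i → when (P? (g i)) (coeff (F (g i)) j))
coeff-sumₚ-filter P? F g zero    j = refl
coeff-sumₚ-filter P? F g (suc n) j
  rewrite ∑-suc n (λ i → when (P? (g i)) (coeff (F (g i)) j)) with P? (g 0)
... | yes _ = trans (coeff-+ (F (g 0)) _ j) (cong (coeff (F (g 0)) j +ᶻ_) (coeff-sumₚ-filter P? F (g ∘ suc) n j))
... | no _  = trans (coeff-sumₚ-filter P? F (g ∘ suc) n j) (sym (ℤP.+-identityˡ _))

coeff-gaussSum : ∀ a n m j → coeff (gaussSum a n m) j
  ≡ ∑ n (λ i → when (suc i ∣? n) (μ (suc i) *ᶻ coeff (a (n * m / suc i) [q^ suc i ]) j))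
coeff-gaussSum a n m j = trans (coeff-sumₚ-filter (λ i → suc i ∣? n) _ id n j)
  (∑-cong n (λ i _ → cong (when (suc i ∣? n)) (coeff-· (μ (suc i)) (a (n * m / suc i) [q^ suc i ]) j)))

coeff-subst-∑ : ∀ {ℓ} {P : ℕ → Set ℓ} (P? : U.Decidable P) e f M (F : ℕ → Poly) →
  (∀ k → coeff f k ≡ ∑ M (λ i → when (P? i) (coeff (F i) k))) →
  ∀ j → coeff (f [q^ suc e ]) j ≡ ∑ M (λ i → when (P? i) (coeff (F i [q^ suc e ]) j))
coeff-subst-∑ P? e f M F f≡∑ j = begin
  coeff (f [q^ suc e ]) j                                             ≡⟨ coeff-subst e f j ⟩
  when e∣j (coeff f (j / suc e))                                      ≡⟨ cong (when e∣j) (f≡∑ (j / suc e)) ⟩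
  when e∣j (∑ M (λ i → when (P? i) (coeff (F i) (j / suc e))))        ≡⟨ when-∑ e∣j M _ ⟩
  ∑ M (λ i → when e∣j (when (P? i) (coeff (F i) (j / suc e))))        ≡⟨ ∑-cong M (λ i _ → trans (when-comm e∣j (P? i) _)
                                                                           (cong (when (P? i)) (sym (coeff-subst e (F i) j)))) ⟩
  ∑ M (λ i → when (P? i) (coeff (F i [q^ suc e ]) j))                 ∎
  where
  open ≡-Reasoning
  e∣j = suc e ∣? j

dirichlet-rearrangement : ∀ {ℓ} {D : ℕ → Set ℓ} N K (D? : U.Decidable D) (G w : ℕ → ℤ) → 1 ≤ N →
  ∑ K (λ i → when (D? i) (w (suc i) *ᶻ ∑ N (λ i′ → when (suc i′ * suc i ∣? N) (G (suc i′ * suc i)))))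
  ≡ ∑ N (λ t → when (suc t ∣? N) (G (suc t) *ᶻ ∑ K (λ i → when (D? i) (when (suc i ∣? suc t) (w (suc i))))))
dirichlet-rearrangement N K D? G w 1≤N = begin
  ∑ K (λ i → when (D? i) (w (suc i) *ᶻ ∑ N (λ i′ → when (suc i′ * suc i ∣? N) (G (suc i′ * suc i)))))
    ≡⟨ ∑-cong K (λ i _ → cong (λ s → when (D? i) (w (suc i) *ᶻ s)) (∑-multiples-dividing N i G 1≤N)) ⟩
  ∑ K (λ i → when (D? i) (w (suc i) *ᶻ ∑ N (λ t → when (suc i ∣? suc t) (when (suc t ∣? N) (G (suc t))))))
    ≡⟨ ∑-cong K (λ i _ → trans (cong (when (D? i)) (sym (∑-*ˡ N (w (suc i)) _)))
                         (trans (when-∑ (D? i) N _) (∑-cong N (λ t _ → regroup i t)))) ⟩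
  ∑ K (λ i → ∑ N (λ t → when (suc t ∣? N) (G (suc t) *ᶻ W i t)))
    ≡⟨ ∑-swap K N _ ⟩
  ∑ N (λ t → ∑ K (λ i → when (suc t ∣? N) (G (suc t) *ᶻ W i t)))
    ≡⟨ ∑-cong N (λ t _ → trans (sym (when-∑ (suc t ∣? N) K _)) (cong (when (suc t ∣? N)) (∑-*ˡ K (G (suc t)) _))) ⟩
  ∑ N (λ t → when (suc t ∣? N) (G (suc t) *ᶻ ∑ K (λ i → W i t))) ∎
  where
  open ≡-Reasoning
  W : ℕ → ℕ → ℤ
  W i t = when (D? i) (when (suc i ∣? suc t) (w (suc i)))
  regroup : ∀ i t → when (D? i) (w (suc i) *ᶻ when (suc i ∣? suc t) (when (suc t ∣? N) (G (suc t))))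
                  ≡ when (suc t ∣? N) (G (suc t) *ᶻ W i t)
  regroup i t = begin
    when (D? i) (w (suc i) *ᶻ when d∣t (when t∣N g))    ≡⟨ cong (when (D? i)) (sym (when-*ˡ d∣t (w (suc i)) (when t∣N g))) ⟩
    when (D? i) (when d∣t (w (suc i) *ᶻ when t∣N g))    ≡⟨ cong (λ x → when (D? i) (when d∣t x)) (sym (when-*ˡ t∣N (w (suc i)) g)) ⟩
    when (D? i) (when d∣t (when t∣N (w (suc i) *ᶻ g)))  ≡⟨ trans (cong (when (D? i)) (when-comm d∣t t∣N _)) (when-comm (D? i) t∣N _) ⟩
    when t∣N (when (D? i) (when d∣t (w (suc i) *ᶻ g)))  ≡⟨ cong (λ x → when t∣N (when (D? i) (when d∣t x))) (ℤP.*-comm (w (suc i)) g) ⟩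
    when t∣N (when (D? i) (when d∣t (g *ᶻ w (suc i))))  ≡⟨ cong (when t∣N) (trans (cong (when (D? i)) (when-*ˡ d∣t g (w (suc i))))
                                                                              (when-*ˡ (D? i) g (when d∣t (w (suc i))))) ⟩
    when t∣N (g *ᶻ W i t)                               ∎
    where
    d∣t = suc i ∣? suc t
    t∣N = suc t ∣? N
    g = G (suc t)

-- Write g_k = Σ_{d ∣ k} μ(d) a_{k/d}(q^d)
-- (the sequence `gaussSum a k 1`).  Then
--   a_N = Σ_{d ∣ N} g_{N/d}(q^d),                                     (inversion)
--   Σ_{d ∣ n} μ(d) a_{nm/d}(q^d) = Σ_{t ∣ nm, gcd(n,t) = 1} g_{nm/t}(q^t).   (decomposition)
-- Both follow from the Dirichlet rearrangement and  Σ_{d ∣ n, d ∣ t} μ(d) = [gcd(n,t) = 1].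

divisorSum-at-1 : ∀ N (G : ℕ → ℤ) → 1 ≤ N →
                  ∑ N (λ t → when (suc t ∣? N) (G (suc t) *ᶻ when (suc t ℕ.≟ 1) (+ 1))) ≡ G 1
divisorSum-at-1 N G 1≤N = trans (∑-single N 0 _ 1≤N (λ t _ t≢0 → vanish t t≢0))
                                (trans (when-yes (1 ∣? N) (1∣ N) _) (ℤP.*-identityʳ (G 1)))
  where
  vanish : ∀ t → t ≢ 0 → when (suc t ∣? N) (G (suc t) *ᶻ when (suc t ℕ.≟ 1) (+ 1)) ≡ + 0
  vanish zero    t≢0 = ⊥-elim (t≢0 refl)
  vanish (suc t) _   = trans (cong (when (suc (suc t) ∣? N)) (ℤP.*-zeroʳ (G (suc (suc t))))) (when-0 (suc (suc t) ∣? N))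

möbius-sum-common-divisors : ∀ n t → 1 ≤ n →
  ∑ n (λ i → when (suc i ∣? n) (when (suc i ∣? suc t) (μ (suc i)))) ≡ when (gcd n (suc t) ℕ.≟ 1) (+ 1)
möbius-sum-common-divisors n t 1≤n = begin
  ∑ n (λ i → when (suc i ∣? n) (when (suc i ∣? suc t) (μ (suc i))))
    ≡⟨ ∑-cong n (λ i _ → when-when (suc i ∣? n) (suc i ∣? suc t) (suc i ∣? g) gcd-greatest
                           (λ d∣g → ∣-trans d∣g (gcd[m,n]∣m n (suc t))) (λ d∣g → ∣-trans d∣g (gcd[m,n]∣n n (suc t))) _) ⟩
  ∑ n (λ i → when (suc i ∣? g) (μ (suc i)))
    ≡⟨ sym (divisorSum-extend g n μ 1≤g (∣⇒≤ ⦃ ℕ.>-nonZero 1≤n ⦄ (gcd[m,n]∣m n (suc t)))) ⟩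
  divisorSum g μ
    ≡⟨ möbius-sum g 1≤g ⟩
  when (g ℕ.≟ 1) (+ 1) ∎
  where
  open ≡-Reasoning
  g = gcd n (suc t)
  1≤g : 1 ≤ g
  1≤g = ℕP.n≢0⇒n>0 (λ g≡0 → ℕP.0≢1+n (sym (0∣⇒≡0 (subst (_∣ suc t) g≡0 (gcd[m,n]∣n n (suc t))))))

quotient-positive : ∀ N d′ → 1 ≤ N → suc d′ ∣ N → 1 ≤ N / suc d′
quotient-positive N d′ 1≤N (divides zero    N≡0) = ⊥-elim (ℕP.<-irrefl (sym N≡0) 1≤N)
quotient-positive N d′ 1≤N (divides (suc q) N≡qd) = subst (1 ≤_) (sym (trans (cong (_/ suc d′) N≡qd) (m*n/n≡m (suc q) (suc d′)))) (s≤s z≤n)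

/-/-comm : ∀ N d e → N / suc d / suc e ≡ N / (suc e * suc d)
/-/-comm N d e = trans (m/n/o≡m/[n*o] N (suc d) (suc e)) (/-congʳ {m = N} (ℕP.*-comm (suc d) (suc e)))

atDivisor : (ℕ → Poly) → ℕ → ℕ → ℕ → ℤ
atDivisor b N j zero    = + 0
atDivisor b N j (suc t) = coeff (b (N / suc t) [q^ suc t ]) j

coeff-gaussSum-subst : ∀ a M i j → coeff (gaussSum a M 1 [q^ suc i ]) j
  ≡ ∑ M (λ e → when (suc e ∣? M) (μ (suc e) *ᶻ coeff (a (M / suc e) [q^ suc e * suc i ]) j))
coeff-gaussSum-subst a M i j = trans
  (coeff-subst-∑ (λ e → suc e ∣? M) i (gaussSum a M 1) M T
    (λ k → trans (coeff-gaussSum a M 1 k) (∑-cong M (λ e _ → cong (when (suc e ∣? M)) (sym (coeff-· (μ (suc e)) (F e) k))))) j)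
  (∑-cong M (λ e _ → cong (when (suc e ∣? M)) (term e)))
  where
  F = λ e → a (M * 1 / suc e) [q^ suc e ]
  T = λ e → μ (suc e) ·ₚ F e
  term : ∀ e → coeff (T e [q^ suc i ]) j ≡ μ (suc e) *ᶻ coeff (a (M / suc e) [q^ suc e * suc i ]) j
  term e = begin
    coeff (T e [q^ suc i ]) j                               ≡⟨ at (subst-· i (μ (suc e)) (F e)) j ⟩
    coeff (μ (suc e) ·ₚ (F e [q^ suc i ])) j                ≡⟨ coeff-· (μ (suc e)) (F e [q^ suc i ]) j ⟩
    μ (suc e) *ᶻ coeff (F e [q^ suc i ]) j                  ≡⟨ cong (μ (suc e) *ᶻ_) (at (subst-subst e i (a (M * 1 / suc e))) j) ⟩
    μ (suc e) *ᶻ coeff (a (M * 1 / suc e) [q^ suc e * suc i ]) j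
                                                            ≡⟨ cong (λ k → μ (suc e) *ᶻ coeff (a (k / suc e) [q^ suc e * suc i ]) j) (ℕP.*-identityʳ M) ⟩
    μ (suc e) *ᶻ coeff (a (M / suc e) [q^ suc e * suc i ]) j ∎
    where open ≡-Reasoning

∑-multiples-factor : ∀ N e c (H : ℕ → ℤ) →
  ∑ N (λ i → when (suc e * suc i ∣? N) (c *ᶻ H (suc e * suc i)))
    ≡ when (suc e ∣? N) (c *ᶻ ∑ N (λ i → when (suc i * suc e ∣? N) (H (suc i * suc e))))
∑-multiples-factor N e c H = trans
  (∑-cong N (λ i _ → trans (cong (λ k → when (k ∣? N) (c *ᶻ H k)) (ℕP.*-comm (suc e) (suc i)))
                           (when-*ˡ (suc i * suc e ∣? N) c _)))
  (trans (∑-*ˡ N c _) (sym (guard-redundant (suc e ∣? N))))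
  where
  S = ∑ N (λ i → when (suc i * suc e ∣? N) (H (suc i * suc e)))
  -- When e ∤ N no multiple of e divides N, so the sum vanishes.
  guard-redundant : (d : Dec (suc e ∣ N)) → when d (c *ᶻ S) ≡ c *ᶻ S
  guard-redundant (yes _)  = refl
  guard-redundant (no e∤N) = sym (trans (cong (c *ᶻ_) (∑-zero N (λ i _ →
    when-no (suc i * suc e ∣? N) (λ ie∣N → e∤N (m*n∣⇒n∣ (suc i) (suc e) ie∣N)) _))) (ℤP.*-zeroʳ c))

möbius-inversion : ∀ a N j → 1 ≤ N →
  coeff (a N) j ≡ ∑ N (λ i → when (suc i ∣? N) (coeff (gaussSum a (N / suc i) 1 [q^ suc i ]) j))
möbius-inversion a N j 1≤N = sym (begin
  ∑ N (λ i → when (suc i ∣? N) (coeff (gaussSum a (N / suc i) 1 [q^ suc i ]) j))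
    ≡⟨ ∑-cong N (λ i _ → cong (when (suc i ∣? N)) (trans (coeff-gaussSum-subst a (N / suc i) i j)
                                                           (∑-cong (N / suc i) (λ e _ → cong (when (suc e ∣? (N / suc i))) (term i e))))) ⟩
  ∑ N (λ i → when (suc i ∣? N) (divisorSum (N / suc i) (λ e → μ e *ᶻ A (e * suc i))))
    ≡⟨ ∑-cong N (λ i _ → divisorSum-quotient N i (λ e → μ e *ᶻ A (e * suc i)) 1≤N) ⟩
  ∑ N (λ i → ∑ N (λ e → when (suc e * suc i ∣? N) (μ (suc e) *ᶻ A (suc e * suc i))))
    ≡⟨ ∑-swap N N _ ⟩
  ∑ N (λ e → ∑ N (λ i → when (suc e * suc i ∣? N) (μ (suc e) *ᶻ A (suc e * suc i))))
    ≡⟨ ∑-cong N (λ e _ → ∑-multiples-factor N e (μ (suc e)) A) ⟩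
  ∑ N (λ e → when (suc e ∣? N) (μ (suc e) *ᶻ ∑ N (λ i → when (suc i * suc e ∣? N) (A (suc i * suc e)))))
    ≡⟨ dirichlet-rearrangement N N (λ i → suc i ∣? N) A μ 1≤N ⟩
  ∑ N (λ t → when (suc t ∣? N) (A (suc t) *ᶻ ∑ N (λ i → when (suc i ∣? N) (when (suc i ∣? suc t) (μ (suc i))))))
    ≡⟨ ∑-cong N (λ t _ → when-cong (suc t ∣? N) (λ t∣N → cong (A (suc t) *ᶻ_) (möbius-sum-divisors t t∣N))) ⟩
  ∑ N (λ t → when (suc t ∣? N) (A (suc t) *ᶻ when (suc t ℕ.≟ 1) (+ 1)))
    ≡⟨ divisorSum-at-1 N A 1≤N ⟩
  coeff (a (N / 1) [q^ 1 ]) j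
    ≡⟨ trans (coeff-subst-1 (a (N / 1)) j) (cong (λ k → coeff (a k) j) (n/1≡n N)) ⟩
  coeff (a N) j ∎)
  where
  open ≡-Reasoning
  A = atDivisor a N j
  term : ∀ i e → μ (suc e) *ᶻ coeff (a (N / suc i / suc e) [q^ suc e * suc i ]) j ≡ μ (suc e) *ᶻ A (suc e * suc i)
  term i e = cong (λ k → μ (suc e) *ᶻ coeff (a k [q^ suc e * suc i ]) j) (/-/-comm N i e)
  möbius-sum-divisors : ∀ t → suc t ∣ N →
    ∑ N (λ i → when (suc i ∣? N) (when (suc i ∣? suc t) (μ (suc i)))) ≡ when (suc t ℕ.≟ 1) (+ 1)
  möbius-sum-divisors t t∣N = trans (∑-cong N (λ i _ → when-redundant (suc i ∣? N) (suc i ∣? suc t) (λ d∣t → ∣-trans d∣t t∣N) _))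
    (trans (sym (divisorSum-extend (suc t) N μ (s≤s z≤n) (∣⇒≤ ⦃ ℕ.>-nonZero 1≤N ⦄ t∣N))) (möbius-sum (suc t) (s≤s z≤n)))

möbius-inversion-subst : ∀ a N i j → 1 ≤ N → suc i ∣ N →
  coeff (a (N / suc i) [q^ suc i ]) j
    ≡ ∑ N (λ e → when (suc e * suc i ∣? N) (atDivisor (λ k → gaussSum a k 1) N j (suc e * suc i)))
möbius-inversion-subst a N i j 1≤N d∣N = begin
  coeff (a X [q^ suc i ]) j
    ≡⟨ coeff-subst-∑ (λ e → suc e ∣? X) i (a X) X (λ e → gaussSum a (X / suc e) 1 [q^ suc e ])
                     (λ k → möbius-inversion a X k (quotient-positive N i 1≤N d∣N)) j ⟩
  ∑ X (λ e → when (suc e ∣? X) (coeff ((gaussSum a (X / suc e) 1 [q^ suc e ]) [q^ suc i ]) j))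
    ≡⟨ ∑-cong X (λ e _ → cong (when (suc e ∣? X)) (term e)) ⟩
  divisorSum X (λ e → B (e * suc i))
    ≡⟨ sym (when-yes (suc i ∣? N) d∣N _) ⟩
  when (suc i ∣? N) (divisorSum X (λ e → B (e * suc i)))
    ≡⟨ divisorSum-quotient N i (λ e → B (e * suc i)) 1≤N ⟩
  ∑ N (λ e → when (suc e * suc i ∣? N) (B (suc e * suc i))) ∎
  where
  open ≡-Reasoning
  X = N / suc i
  B = atDivisor (λ k → gaussSum a k 1) N j
  term : ∀ e → coeff ((gaussSum a (X / suc e) 1 [q^ suc e ]) [q^ suc i ]) j ≡ B (suc e * suc i)
  term e = trans (at (subst-subst e i (gaussSum a (X / suc e) 1)) j)
                 (cong (λ k → coeff (gaussSum a k 1 [q^ suc e * suc i ]) j) (/-/-comm N i e))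

gaussSum-decomposition : ∀ a n m j → 1 ≤ n → 1 ≤ m →
  coeff (gaussSum a n m) j ≡ ∑ (n * m) (λ t → when (suc t ∣? n * m) (when (gcd n (suc t) ℕ.≟ 1)
                                 (coeff (gaussSum a (n * m / suc t) 1 [q^ suc t ]) j)))
gaussSum-decomposition a n m j 1≤n 1≤m = begin
  coeff (gaussSum a n m) j
    ≡⟨ coeff-gaussSum a n m j ⟩
  ∑ n (λ i → when (suc i ∣? n) (μ (suc i) *ᶻ coeff (a (N / suc i) [q^ suc i ]) j))
    ≡⟨ ∑-cong n (λ i _ → when-cong (suc i ∣? n) (λ d∣n → cong (μ (suc i) *ᶻ_)
                           (möbius-inversion-subst a N i j 1≤N (∣-trans d∣n (m∣m*n m))))) ⟩
  ∑ n (λ i → when (suc i ∣? n) (μ (suc i) *ᶻ ∑ N (λ e → when (suc e * suc i ∣? N) (B (suc e * suc i)))))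
    ≡⟨ dirichlet-rearrangement N n (λ i → suc i ∣? n) B μ 1≤N ⟩
  ∑ N (λ t → when (suc t ∣? N) (B (suc t) *ᶻ ∑ n (λ i → when (suc i ∣? n) (when (suc i ∣? suc t) (μ (suc i))))))
    ≡⟨ ∑-cong N (λ t _ → cong (when (suc t ∣? N)) (trans (cong (B (suc t) *ᶻ_) (möbius-sum-common-divisors n t 1≤n))
                                                          (*-indicator (gcd n (suc t) ℕ.≟ 1) (B (suc t))))) ⟩
  ∑ N (λ t → when (suc t ∣? N) (when (gcd n (suc t) ℕ.≟ 1) (B (suc t)))) ∎
  where
  open ≡-Reasoning
  N = n * m
  1≤N = ℕP.*-mono-≤ 1≤n 1≤m
  B = atDivisor (λ k → gaussSum a k 1) N j
  *-indicator : ∀ {p} {P : Set p} (d : Dec P) x → x *ᶻ when d (+ 1) ≡ when d x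
  *-indicator (yes _) x = ℤP.*-identityʳ x
  *-indicator (no _)  x = ℤP.*-zeroʳ x

∑ₚ : ℕ → (ℕ → Poly) → Poly
∑ₚ zero    F = []
∑ₚ (suc n) F = ∑ₚ n F +ₚ F n

coeff-∑ₚ : ∀ n F j → coeff (∑ₚ n F) j ≡ ∑ n (λ i → coeff (F i) j)
coeff-∑ₚ zero    F j = refl
coeff-∑ₚ (suc n) F j = trans (coeff-+ (∑ₚ n F) (F n) j) (cong (_+ᶻ coeff (F n) j) (coeff-∑ₚ n F j))

∣≋-∑ₚ : ∀ g n F → (∀ i → i < n → g ∣≋ F i) → g ∣≋ ∑ₚ n F
∣≋-∑ₚ g zero    F g∣F = ∣≋-[] g
∣≋-∑ₚ g (suc n) F g∣F = ∣≋-+ (∣≋-∑ₚ g n F (λ i i<n → g∣F i (ℕP.m<n⇒m<1+n i<n))) (g∣F n ℕP.≤-refl)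

whenₚ : ∀ {p} {P : Set p} → Dec P → Poly → Poly
whenₚ (yes _) f = f
whenₚ (no _)  _ = []

coeff-whenₚ : ∀ {p} {P : Set p} (d : Dec P) f j → coeff (whenₚ d f) j ≡ when d (coeff f j)
coeff-whenₚ (yes _) f j = refl
coeff-whenₚ (no _)  f j = refl

-- Part (2), "⇐": each term g_{nm/t}(q^t) of the decomposition is divisible
-- by [n]_q, since n ∣ nm/t when gcd(n, t) = 1 and [nm/t]_q ∣ g_{nm/t}.

term-divisible : ∀ a → qGauss a → ∀ n′ t q → Coprime (suc n′) (suc t) → suc n′ ∣ q → 1 ≤ q →
                 [ suc n′ ]q ∣≋ gaussSum a q 1 [q^ suc t ]
term-divisible a gauss n′ t .(s * suc n′) coprime (divides-refl s) 1≤q =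
  qint-∣-subst-of-multiple n′ t s (gaussSum a (s * suc n′) 1) coprime
    (≡0⇒∣≋ {gaussSum a (s * suc n′) 1} {[ s * suc n′ ]q} (gauss (s * suc n′) 1≤q))

qGauss⇒qGaussWrt-primes : ∀ a → qGauss a → qGaussWrt Prime a
qGauss⇒qGaussWrt-primes a gauss zero     m (() , _) _
qGauss⇒qGaussWrt-primes a gauss (suc n′) m (1≤n , _) 1≤m =
  ∣≋⇒≡0 (∣≋-resp (≋-sym decomposed) (∣≋-∑ₚ [ n ]q N T term-∣))
  where
  n = suc n′
  N = n * m
  T : ℕ → Poly
  T t = whenₚ (suc t ∣? N) (whenₚ (gcd n (suc t) ℕ.≟ 1) (gaussSum a (N / suc t) 1 [q^ suc t ]))
  decomposed : gaussSum a n m ≋ ∑ₚ N T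
  decomposed = coeffwise λ j → trans (gaussSum-decomposition a n m j 1≤n 1≤m) (sym (trans (coeff-∑ₚ N T j)
    (∑-cong N (λ t _ → trans (coeff-whenₚ (suc t ∣? N) _ j) (cong (when (suc t ∣? N)) (coeff-whenₚ (gcd n (suc t) ℕ.≟ 1) _ j))))))
  term-∣ : ∀ t → t < N → [ n ]q ∣≋ T t
  term-∣ t _ with suc t ∣? N | gcd n (suc t) ℕ.≟ 1
  ... | no _                 | _        = ∣≋-[] [ n ]q
  ... | yes _                | no _     = ∣≋-[] [ n ]q
  ... | yes (divides q N≡qt) | yes gcd≡1 =
    subst (λ k → [ n ]q ∣≋ gaussSum a k 1 [q^ suc t ]) (sym N/t≡q)
          (term-divisible a gauss n′ t q coprime n∣q (ℕP.n≢0⇒n>0 q≢0))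
    where
    coprime = gcd≡1⇒coprime gcd≡1
    N/t≡q : N / suc t ≡ q
    N/t≡q = trans (cong (_/ suc t) N≡qt) (m*n/n≡m q (suc t))
    n∣q : n ∣ q
    n∣q = coprime-divisor coprime (subst (n ∣_) (trans N≡qt (ℕP.*-comm q (suc t))) (m∣m*n m))
    q≢0 : q ≢ 0
    q≢0 refl = ℕP.<-irrefl (sym N≡qt) (ℕP.*-mono-≤ 1≤n 1≤m)

-- Part (1): for a prime power P = p^(k+1) the only divisors of P with
-- μ ≠ 0 are 1 and p, so the Gauss sum is a_{Pn}(q) − a_{Pn/p}(q^p).
gaussSum-prime-power : ∀ p′ k n → Prime (suc p′) → ∀ a →
  gaussSum a (suc p′ ^ suc k) n ≋ a (suc p′ ^ suc k * n) -ₚ a (suc p′ ^ k * n) [q^ suc p′ ]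
gaussSum-prime-power p′ k n pp a = coeffwise λ j → begin
  coeff (gaussSum a P n) j                ≡⟨ coeff-gaussSum a P n j ⟩
  ∑ P (term j)                            ≡⟨ ∑-pair P 0 p′ (term j) (ℕP.n≢0⇒n>0 p′≢0) p′<P (vanish j) ⟩
  term j 0 +ᶻ term j p′                   ≡⟨ cong₂ _+ᶻ_ (term-1 j) (term-p j) ⟩
  coeff (a (P * n)) j +ᶻ -ᶻ coeff (a (p ^ k * n) [q^ p ]) j
                                          ≡⟨ sym (coeff-- (a (P * n)) _ j) ⟩
  coeff (a (P * n) -ₚ a (p ^ k * n) [q^ p ]) j ∎
  where
  open ≡-Reasoning
  p = suc p′
  P = p ^ suc k
  term : ℕ → ℕ → ℤ
  term j i = when (suc i ∣? P) (μ (suc i) *ᶻ coeff (a (P * n / suc i) [q^ suc i ]) j)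
  p′≢0 : p′ ≢ 0
  p′≢0 refl = ℕ.nonTrivial⇒≢1 ⦃ prime⇒nonTrivial pp ⦄ refl
  p′<P : p′ < P
  p′<P = ℕP.m≤m*n p (p ^ k) ⦃ ℕ.>-nonZero (ℕP.m^n>0 p k) ⦄
  vanish : ∀ j i → i < P → i ≢ 0 → i ≢ p′ → term j i ≡ + 0
  vanish j i _ i≢0 i≢p′ with suc i ∣? P
  ... | no _ = refl
  ... | yes d∣P with prime^-divisor pp (suc k) (suc i) d∣P
  ...   | inj₁ refl         = ⊥-elim (i≢0 refl)
  ...   | inj₂ (inj₁ refl)  = ⊥-elim (i≢p′ refl)
  ...   | inj₂ (inj₂ p²∣d)  = cong (_*ᶻ coeff (a (P * n / suc i) [q^ suc i ]) j) (μ-non-squarefree p (suc i) (prime>1 pp) p²∣d (s≤s z≤n))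
  term-1 : ∀ j → term j 0 ≡ coeff (a (P * n)) j
  term-1 j = trans (when-yes (1 ∣? P) (1∣ P) _) (trans (ℤP.*-identityˡ _)
               (trans (coeff-subst-1 (a (P * n / 1)) j) (cong (λ k → coeff (a k) j) (n/1≡n (P * n)))))
  term-p : ∀ j → term j p′ ≡ -ᶻ coeff (a (p ^ k * n) [q^ p ]) j
  term-p j = trans (when-yes (p ∣? P) (m∣m*n (p ^ k)) _)
    (trans (cong₂ _*ᶻ_ (μ-prime p pp) (cong (λ k → coeff (a k [q^ p ]) j) Pn/p≡p^kn)) (ℤP.-1*i≡-i _))
    where
    Pn/p≡p^kn : P * n / p ≡ p ^ k * n
    Pn/p≡p^kn = trans (cong (_/ p) (trans (ℕP.*-assoc p (p ^ k) n) (ℕP.*-comm p (p ^ k * n)))) (m*n/n≡m (p ^ k * n) p)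

prime-power-in-N : ∀ (S : ℕ → Set) p → S p → Prime p → ∀ k → InN S (p ^ k)
prime-power-in-N S p Sp pp k = ℕP.m^n>0 p ⦃ prime⇒nonZero pp ⦄ k , λ r rr r∣p^k → subst S (sym (prime∣prime^ rr pp k r∣p^k)) Sp

-- Part (1): the q-Gauss congruence for (p^k, n), with p^k ∈ N_S, is the claim.
congruence-prime-power : ∀ (S : ℕ → Set) → (∀ p → S p → Prime p) → (a : ℕ → Poly) → qGaussWrt S a →
  ∀ p → S p → ∀ n k → 1 ≤ n → 1 ≤ k → a (p ^ k * n) ≡ (a (p ^ (k ∸ 1) * n)) [q^ p ] [modₚ [ p ^ k ]q ]
congruence-prime-power S primes a gaussS zero     Sp n k       _   _   = ⊥-elim (¬prime[0] (primes 0 Sp))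
congruence-prime-power S primes a gaussS (suc p′) Sp n (suc k) 1≤n _   =
  ∣≋⇒∣ₚ (∣≋-resp (gaussSum-prime-power p′ k n pp a)
                   (≡0⇒∣≋ {gaussSum a (suc p′ ^ suc k) n} {[ suc p′ ^ suc k ]q}
                          (gaussS (suc p′ ^ suc k) n (prime-power-in-N S (suc p′) Sp pp (suc k)) 1≤n)))
  where pp = primes (suc p′) Sp

lemma2p2 : ((S : ℕ → Set) → (∀ p → S p → Prime p) → (a : ℕ → Poly) → qGaussWrt S a →
             ∀ p → S p → ∀ n k → 1 ≤ n → 1 ≤ k →
             a (p ^ k * n) ≡ (a (p ^ (k ∸ 1) * n)) [q^ p ] [modₚ [ p ^ k ]q ])
           × ((a : ℕ → Poly) → (qGaussWrt Prime a ⇔ qGauss a))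
lemma2p2 = congruence-prime-power , λ a → mk⇔ (qGaussWrt-primes⇒qGauss a) (qGauss⇒qGaussWrt-primes a)
  where
  qGaussWrt-primes⇒qGauss : ∀ a → qGaussWrt Prime a → qGauss a
  qGaussWrt-primes⇒qGauss a gaussP n 1≤n = gaussP n 1 (1≤n , λ _ pp _ → pp) (s≤s z≤n)
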